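{- Let $D$ be a diagram all of whose cells lie in rows $2<r_1<r_2<\cdots<r_n$ (in particular rows $1$ and $2$ are empty), and suppose $\mathcal{P}(D)$ is shellable. Let $c^*$ be the rightmost nonempty column of $D$ and $r^*$ the largest integer with $(r^*,c^*)\in D$. Then for every $(\tilde r,\tilde c)\in D$ with $\tilde c<c^*$ we have $\tilde r\ge r^*$.
   Context: A diagram is a finite set of cells in $\mathbb{Z}_{>0}\times\mathbb{Z}_{>0}$; a cell $(r,c)$ lies in row $r$ (rows numbered from the bottom, starting at $1$) and column $c$. Applying a Kohnert move at row $r$ of a diagram $D$: if row $r$ is nonempty, let $(r,c)$ be its rightmost cell; if there is $r'$ with $1\le r'<r$ and $(r',c)\notin D$, take the largest such $r'$ and replace $(r,c)$ by $(r',c)$; otherwise $D$ is unchanged. The Kohnert poset $\mathcal{P}(D)$ is the set of diagrams obtainable from $D$ by finite (possibly empty) sequences of Kohnert moves, with $D_2\preceq D_1$ iff $D_2$ can be obtained from $D_1$ by Kohnert moves. A finite poset is shellable if its order complex (the simplicial complex of its chains) is shellable: its facets can be ordered $F_1,\dots,F_t$ so that for each $2\le k\le t$ the complex $\left(\bigcup_{i<k}\overline{F_i}\right)\cap\overline{F_k}$ is pure of dimension $\dim F_k-1$ ($\overline F$ = all subsets of $F$, $\dim F=|F|-1$). -}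

module Defs where

open import Level using (0ℓ)
open import Data.Nat using (ℕ; _≤_; _<_)
open import Data.Product using (_×_; Σ; ∃; ∃-syntax; _,_)
open import Data.Sum using (_⊎_)
open import Data.List using (List; []; _∷_; _++_; length)
open import Data.List.Membership.Propositional using (_∈_; _∉_)
open import Data.List.Relation.Unary.All using (All)
open import Data.List.Relation.Unary.Any using (Any)
open import Data.List.Relation.Unary.AllPairs using (AllPairs)
import Data.List.Relation.Binary.Sublist.Propositional as SL
open import Relation.Binary.PropositionalEquality using (_≡_; _≢_)
open import Relation.Nullary using (¬_)

-- A cell is (row , column); rows numbered from the bottom starting at 1.
Cell : Set
Cell = ℕ × ℕ

-- A diagram is a finite set of cells, represented by a list (duplicates
-- and order irrelevant); diagrams are compared by set equality _≐_.
Diagram : Set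
Diagram = List Cell

_⇔_ : Set → Set → Set
A ⇔ B = (A → B) × (B → A)

_≐_ : Diagram → Diagram → Set
D ≐ E = ∀ (x : Cell) → (x ∈ D) ⇔ (x ∈ E)

-- A Kohnert move at row r that actually changes D, producing E
-- (E is specified up to set equality by its membership).
KohnertStep : Diagram → Diagram → Set
KohnertStep D E =
  Σ ℕ λ r → Σ ℕ λ c → Σ ℕ λ r' →
    ((r , c) ∈ D)
  × (∀ c' → (r , c') ∈ D → c' ≤ c)
  × (1 ≤ r') × (r' < r) × ((r' , c) ∉ D)
  × (∀ s → r' < s → s < r → (s , c) ∈ D)
  × (∀ x → (x ∈ E) ⇔ (((x ∈ D) × (x ≢ (r , c))) ⊎ (x ≡ (r' , c))))

-- Reach D E : E is obtainable from D by a finite (possibly empty) sequence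
-- of Kohnert moves (moves that leave the diagram unchanged are omitted,
-- as they do not change the diagram).  E ⪯ D in the Kohnert poset.
data Reach : Diagram → Diagram → Set where
  done : ∀ {D E} → D ≐ E → Reach D E
  step : ∀ {D E F} → KohnertStep D E → Reach E F → Reach D F

-- Elements of the Kohnert poset P(D) are the diagrams E with Reach D E,
-- taken up to set equality.  Lists of such elements, up to _≐_:
_∈≐_ : Diagram → List Diagram → Set
E ∈≐ Cs = Any (λ F → E ≐ F) Cs

_⊆≐_ : List Diagram → List Diagram → Set
Cs ⊆≐ Ds = All (λ E → E ∈≐ Ds) Cs

_≈F_ : List Diagram → List Diagram → Set
Cs ≈F Ds = (Cs ⊆≐ Ds) × (Ds ⊆≐ Cs)

-- A face of the order complex of P(D): a chain, i.e. a finite set of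
-- pairwise distinct, pairwise comparable elements of P(D).
IsChain : Diagram → List Diagram → Set
IsChain D Cs =
    All (Reach D) Cs
  × AllPairs (λ E F → Reach E F ⊎ Reach F E) Cs
  × AllPairs (λ E F → ¬ (E ≐ F)) Cs

IsFacet : Diagram → List Diagram → Set
IsFacet D F = IsChain D F × (∀ G → IsChain D G → F ⊆≐ G → G ⊆≐ F)

-- For a facet Fk and earlier facets pre, the complex
--   (⋃_{F ∈ pre} closure F) ∩ closure Fk
-- whose faces are the subsets of Fk (represented as sublists of Fk)
-- contained in some F ∈ pre.
InΔ : List (List Diagram) → List Diagram → List Diagram → Set
InΔ pre Fk G = (G SL.⊆ Fk) × Any (λ Fi → G ⊆≐ Fi) pre

-- That complex is pure of dimension dim Fk - 1: every facet (maximal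
-- face) G of it has |G| - 1 = (|Fk| - 1) - 1, i.e. |G| + 1 = |Fk|.
PureCodim1 : List (List Diagram) → List Diagram → Set
PureCodim1 pre Fk =
  ∀ G → InΔ pre Fk G
      → (∀ G' → InΔ pre Fk G' → G ⊆≐ G' → G' ⊆≐ G)
      → Data.Nat.suc (length G) ≡ length Fk

IsShelling : Diagram → List (List Diagram) → Set
IsShelling D Fs =
    All (IsFacet D) Fs
  × (∀ F → IsFacet D F → Any (λ G → F ≈F G) Fs)
  × AllPairs (λ F G → ¬ (F ≈F G)) Fs
  × (∀ pre Fk post → Fs ≡ pre ++ (Fk ∷ post) → pre ≢ [] → PureCodim1 pre Fk)

KohnertShellable : Diagram → Set
KohnertShellable D = ∃[ Fs ] IsShelling D Fs

module Submission where

-- Suppose a cell (rt , ct) with ct < cs lies below row rs. Going down from it, always to the rightmost cell left of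
-- column cs, we reach a cell (p + 1 , ct) with (p , ct) empty, and p ≥ 2 since rows 1 and 2 are empty. Kohnert moves in
-- column cs, whose cells are rightmost in their rows, bring a cell of that column down to row p + 2 and, using the empty
-- rows 1 and 2, clear rows p and p + 1 of it. In the resulting diagram y the cell (p + 2 , cs) can drop twice and
-- (p + 1 , ct) once, the latter either after or before the other two drops. The interval from y down to the common
-- result x consists of exactly these two chains, and they are incomparable: this is read off the column weights (the
-- sum of the rows of the cells of a column), which Kohnert moves never increase. Such an interval rules out a shelling:
-- of two facets that differ only inside the interval, the later one without its two middle elements is a maximal face
-- of its intersection with the earlier facets, of codimension 2.

open import Defs
open import Level using (0ℓ)
open import Function using (_∘_)
open import Data.Empty using (⊥; ⊥-elim)
open import Data.Nat using (ℕ; zero; suc; _≤_; _<_; _+_; _∸_; z≤n; s≤s; _≟_; _<?_; _≤?_)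
import Data.Nat.Properties as ℕₚ
open import Algebra.Properties.CommutativeSemigroup ℕₚ.+-commutativeSemigroup using () renaming (interchange to +-interchange)
open import Data.Product using (_×_; ∃-syntax; _,_; proj₁; proj₂)
import Data.Product as Product
open import Data.Product.Properties using (≡-dec)
open import Data.Sum using (_⊎_; inj₁; inj₂)
import Data.Sum as Sum
open import Data.List using (List; []; _∷_; _++_; length; filter; map)
import Data.List.Properties as Listₚ
open import Data.List.Extrema.Nat using (argmax; argmax-all; f[xs]≤f[argmax]; max; xs≤max)
open import Data.List.Membership.Propositional using (_∈_; _∉_; find)
open import Data.List.Membership.Propositional.Properties using (∈-filter⁺; ∈-filter⁻; ∈-∃++; ∈-++⁺ʳ; ∈-map⁺)
import Data.List.Membership.Setoid.Properties as SetoidMembershipₚ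
open import Data.List.Relation.Unary.All using (All; []; _∷_)
import Data.List.Relation.Unary.All as All
import Data.List.Relation.Unary.All.Properties as Allₚ
open import Data.List.Relation.Unary.AllPairs using (AllPairs; []; _∷_)
import Data.List.Relation.Unary.AllPairs.Properties as AllPairsₚ
open import Data.List.Relation.Unary.Any using (Any; here; there)
import Data.List.Relation.Unary.Any as Any
import Data.List.Relation.Binary.Sublist.Propositional as SL
import Data.List.Relation.Binary.Sublist.Propositional.Properties as SLₚ
open import Relation.Nullary using (¬_; Dec; yes; no; ¬?)
open import Relation.Nullary.Decidable using (_×-dec_)
open import Relation.Binary.Bundles using (Setoid; DecSetoid)
open import Relation.Binary.Definitions using (DecidableEquality; Decidable)
open import Relation.Binary.PropositionalEquality
  using (_≡_; _≢_; refl; sym; trans; cong; cong₂; subst; subst₂; module ≡-Reasoning)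

_≟ᶜ_ : DecidableEquality Cell
_≟ᶜ_ = ≡-dec _≟_ _≟_

open import Data.List.Membership.DecPropositional _≟ᶜ_ using (_∈?_)
open import Data.List.Relation.Binary.Subset.DecPropositional _≟ᶜ_ using (_⊆?_)

⇔-refl : ∀ {A} → A ⇔ A
⇔-refl = (λ a → a) , (λ a → a)

⇔-sym : ∀ {A B} → A ⇔ B → B ⇔ A
⇔-sym (f , g) = g , f

⇔-trans : ∀ {A B C} → A ⇔ B → B ⇔ C → A ⇔ C
⇔-trans (f , g) (h , k) = (λ a → h (f a)) , (λ c → g (k c))

≐-refl : ∀ {E} → E ≐ E
≐-refl x = ⇔-refl

≐-sym : ∀ {E F} → E ≐ F → F ≐ E
≐-sym e x = ⇔-sym (e x)

≐-trans : ∀ {E F G} → E ≐ F → F ≐ G → E ≐ G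
≐-trans e f x = ⇔-trans (e x) (f x)

_≐?_ : Decidable _≐_
E ≐? F with E ⊆? F | F ⊆? E
... | yes E⊆F | yes F⊆E = yes λ x → E⊆F , F⊆E
... | no E⊈F | _ = no λ e → E⊈F (proj₁ (e _))
... | _ | no F⊈E = no λ e → F⊈E (proj₂ (e _))

_≐[_]_ : Diagram → ℕ → Diagram → Set
E ≐[ c ] F = ∀ i → ((i , c) ∈ E) ⇔ ((i , c) ∈ F)

≐[]-refl : ∀ {E c} → E ≐[ c ] E
≐[]-refl i = ⇔-refl

≐[]-sym : ∀ {E F c} → E ≐[ c ] F → F ≐[ c ] E
≐[]-sym e i = ⇔-sym (e i)

≐[]-trans : ∀ {E F G c} → E ≐[ c ] F → F ≐[ c ] G → E ≐[ c ] G
≐[]-trans e f i = ⇔-trans (e i) (f i)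

≐⇒≐[] : ∀ {E F c} → E ≐ F → E ≐[ c ] F
≐⇒≐[] e i = e _

≐[]⇒≐ : ∀ {E F} → (∀ c → E ≐[ c ] F) → E ≐ F
≐[]⇒≐ e (i , c) = e c i

lower : ℕ → ℕ → Diagram → Diagram
lower r c E = (r , c) ∷ filter (λ x → ¬? (x ≟ᶜ (suc r , c))) E

∈-lower : ∀ r c E x → (x ∈ lower r c E) ⇔ (((x ∈ E) × (x ≢ (suc r , c))) ⊎ (x ≡ (r , c)))
∈-lower r c E x = to , from
  where
  to : x ∈ lower r c E → ((x ∈ E) × (x ≢ (suc r , c))) ⊎ (x ≡ (r , c))
  to (here x≡) = inj₂ x≡
  to (there x∈) = inj₁ (∈-filter⁻ (λ x → ¬? (x ≟ᶜ (suc r , c))) x∈)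
  from : ((x ∈ E) × (x ≢ (suc r , c))) ⊎ (x ≡ (r , c)) → x ∈ lower r c E
  from (inj₁ (x∈ , x≢)) = there (∈-filter⁺ (λ x → ¬? (x ≟ᶜ (suc r , c))) x∈ x≢)
  from (inj₂ x≡) = here x≡

lower-untouched : ∀ r c E {x} → x ≢ (suc r , c) → x ≢ (r , c) → (x ∈ lower r c E) ⇔ (x ∈ E)
lower-untouched r c E {x} ≢src ≢tgt = to , λ x∈ → proj₂ (∈-lower r c E x) (inj₁ (x∈ , ≢src))
  where
  to : x ∈ lower r c E → x ∈ E
  to x∈ with proj₁ (∈-lower r c E x) x∈
  ... | inj₁ (x∈E , _) = x∈E
  ... | inj₂ x≡ = ⊥-elim (≢tgt x≡)

lower-otherColumn : ∀ r c E {j} → c ≢ j → lower r c E ≐[ j ] E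
lower-otherColumn r c E c≢j i = lower-untouched r c E (λ e → c≢j (sym (cong proj₂ e))) (λ e → c≢j (sym (cong proj₂ e)))

lower-cong : ∀ r c {E F} → E ≐[ c ] F → lower r c E ≐[ c ] lower r c F
lower-cong r c {E} {F} e i = transport e , transport (≐[]-sym e)
  where
  transport : ∀ {G H} → G ≐[ c ] H → (i , c) ∈ lower r c G → (i , c) ∈ lower r c H
  transport {G} {H} g x∈ with proj₁ (∈-lower r c G _) x∈
  ... | inj₁ (x∈G , x≢) = proj₂ (∈-lower r c H _) (inj₁ (proj₁ (g i) x∈G , x≢))
  ... | inj₂ x≡ = proj₂ (∈-lower r c H _) (inj₂ x≡)

lower-step : ∀ {E r c} → (suc r , c) ∈ E → (∀ c' → (suc r , c') ∈ E → c' ≤ c) → 1 ≤ r → (r , c) ∉ E →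
             KohnertStep E (lower r c E)
lower-step {E} {r} {c} src∈ rightmost 1≤r tgt∉ =
  suc r , c , r , src∈ , rightmost , 1≤r , ℕₚ.≤-refl , tgt∉ ,
  (λ s r<s s<1+r → ⊥-elim (ℕₚ.<-irrefl refl (ℕₚ.<-≤-trans r<s (ℕₚ.≤-pred s<1+r)))) , ∈-lower r c E

module Step {E F : Diagram} (s : KohnertStep E F) where
  row col target : ℕ
  row = proj₁ s
  col = proj₁ (proj₂ s)
  target = proj₁ (proj₂ (proj₂ s))

  cell∈ : (row , col) ∈ E
  cell∈ = let (_ , _ , _ , cell∈ , _) = s in cell∈
  rightmost : ∀ c' → (row , c') ∈ E → c' ≤ col
  rightmost = let (_ , _ , _ , _ , rightmost , _) = s in rightmost
  target<row : target < row
  target<row = let (_ , _ , _ , _ , _ , _ , target<row , _) = s in target<row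
  target∉ : (target , col) ∉ E
  target∉ = let (_ , _ , _ , _ , _ , _ , _ , target∉ , _) = s in target∉
  ∈-result : ∀ x → (x ∈ F) ⇔ (((x ∈ E) × (x ≢ (row , col))) ⊎ (x ≡ (target , col)))
  ∈-result = let (_ , _ , _ , _ , _ , _ , _ , _ , _ , ∈-result) = s in ∈-result

  otherColumn : ∀ {c} → c ≢ col → E ≐[ c ] F
  otherColumn c≢ i = (λ x∈ → proj₂ (∈-result _) (inj₁ (x∈ , λ e → c≢ (cong proj₂ e)))) , back
    where
    back : (i , _) ∈ F → (i , _) ∈ E
    back x∈ with proj₁ (∈-result _) x∈
    ... | inj₁ (x∈E , _) = x∈E
    ... | inj₂ e = ⊥-elim (c≢ (cong proj₂ e))

  ∈-movedColumn : ∀ i → ((i , col) ∈ F) ⇔ ((((i , col) ∈ E) × (i ≢ row)) ⊎ (i ≡ target))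
  ∈-movedColumn i = to , from
    where
    to : (i , col) ∈ F → (((i , col) ∈ E) × (i ≢ row)) ⊎ (i ≡ target)
    to x∈ with proj₁ (∈-result _) x∈
    ... | inj₁ (x∈E , x≢) = inj₁ (x∈E , λ e → x≢ (cong (_, col) e))
    ... | inj₂ e = inj₂ (cong proj₁ e)
    from : (((i , col) ∈ E) × (i ≢ row)) ⊎ (i ≡ target) → (i , col) ∈ F
    from (inj₁ (x∈E , i≢)) = proj₂ (∈-result _) (inj₁ (x∈E , λ e → i≢ (cong proj₁ e)))
    from (inj₂ refl) = proj₂ (∈-result _) (inj₂ refl)

step-resp-≐ : ∀ {E E' F F'} → E ≐ E' → F ≐ F' → KohnertStep E F → KohnertStep E' F'
step-resp-≐ {E} {E'} {F} {F'} e f (r , c , r' , r∈ , rm , 1≤r' , r'<r , r'∉ , between , result) =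
  r , c , r' , proj₁ (e _) r∈ , (λ c' x∈ → rm c' (proj₂ (e _) x∈)) , 1≤r' , r'<r ,
  (λ x∈ → r'∉ (proj₂ (e _) x∈)) , (λ s a b → proj₁ (e _) (between s a b)) ,
  λ x → ⇔-trans (⇔-sym (f x)) (⇔-trans (result x) (convert (e x)))
  where
  convert : ∀ {x} → (x ∈ E) ⇔ (x ∈ E') →
            (((x ∈ E) × (x ≢ (r , c))) ⊎ (x ≡ (r' , c))) ⇔ (((x ∈ E') × (x ≢ (r , c))) ⊎ (x ≡ (r' , c)))
  convert (to , from) = Sum.map (Product.map₁ to) (λ x → x) , Sum.map (Product.map₁ from) (λ x → x)

reach-resp-≐ : ∀ {E E' F F'} → E ≐ E' → F ≐ F' → Reach E F → Reach E' F'
reach-resp-≐ e f (done g) = done (≐-trans (≐-sym e) (≐-trans g f))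
reach-resp-≐ e f (step s r) = step (step-resp-≐ e ≐-refl s) (reach-resp-≐ ≐-refl f r)

reach-refl : ∀ {E} → Reach E E
reach-refl = done ≐-refl

reach-trans : ∀ {E F G} → Reach E F → Reach F G → Reach E G
reach-trans (done e) r = reach-resp-≐ (≐-sym e) ≐-refl r
reach-trans (step s r) r' = step s (reach-trans r r')

reach-step : ∀ {E F} → KohnertStep E F → Reach E F
reach-step s = step s reach-refl

sumTo : ℕ → (ℕ → ℕ) → ℕ
sumTo zero f = f 0
sumTo (suc n) f = sumTo n f + f (suc n)

sumTo-cong : ∀ n {f g} → (∀ i → i ≤ n → f i ≡ g i) → sumTo n f ≡ sumTo n g
sumTo-cong zero f≡g = f≡g 0 z≤n
sumTo-cong (suc n) f≡g = cong₂ _+_ (sumTo-cong n (λ i i≤n → f≡g i (ℕₚ.m≤n⇒m≤1+n i≤n))) (f≡g (suc n) ℕₚ.≤-refl)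

sumTo-mono-≤ : ∀ n {f g} → (∀ i → i ≤ n → f i ≤ g i) → sumTo n f ≤ sumTo n g
sumTo-mono-≤ zero f≤g = f≤g 0 z≤n
sumTo-mono-≤ (suc n) f≤g = ℕₚ.+-mono-≤ (sumTo-mono-≤ n (λ i i≤n → f≤g i (ℕₚ.m≤n⇒m≤1+n i≤n))) (f≤g (suc n) ℕₚ.≤-refl)

sumTo-mono-< : ∀ n {f g} k → k ≤ n → (∀ i → i ≤ n → f i ≤ g i) → f k < g k → sumTo n f < sumTo n g
sumTo-mono-< zero zero _ _ fk<gk = fk<gk
sumTo-mono-< (suc n) k k≤1+n f≤g fk<gk with ℕₚ.m≤n⇒m<n∨m≡n k≤1+n
... | inj₁ (s≤s k≤n) = ℕₚ.+-mono-<-≤ (sumTo-mono-< n k k≤n (λ i i≤n → f≤g i (ℕₚ.m≤n⇒m≤1+n i≤n)) fk<gk) (f≤g (suc n) ℕₚ.≤-refl)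
... | inj₂ refl = ℕₚ.+-mono-≤-< (sumTo-mono-≤ n (λ i i≤n → f≤g i (ℕₚ.m≤n⇒m≤1+n i≤n))) fk<gk

sumTo-+ : ∀ n f g → sumTo n (λ i → f i + g i) ≡ sumTo n f + sumTo n g
sumTo-+ zero f g = refl
sumTo-+ (suc n) f g = trans (cong (_+ (f (suc n) + g (suc n))) (sumTo-+ n f g)) (+-interchange (sumTo n f) (sumTo n g) _ _)

pointMass : ℕ → ℕ → ℕ → ℕ
pointMass k v i with i ≟ k
... | yes _ = v
... | no _ = 0

pointMass-≡ : ∀ k v {i} → i ≡ k → pointMass k v i ≡ v
pointMass-≡ k v {i} i≡k with i ≟ k
... | yes _ = refl
... | no i≢k = ⊥-elim (i≢k i≡k)

pointMass-≢ : ∀ k v {i} → i ≢ k → pointMass k v i ≡ 0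
pointMass-≢ k v {i} i≢k with i ≟ k
... | yes i≡k = ⊥-elim (i≢k i≡k)
... | no _ = refl

sumTo-pointMass : ∀ n k v → k ≤ n → sumTo n (pointMass k v) ≡ v
sumTo-pointMass n k v k≤n = go n k≤n
  where
  zeroBelow : ∀ m → m < k → sumTo m (pointMass k v) ≡ 0
  zeroBelow zero 0<k = pointMass-≢ k v (λ e → ℕₚ.<-irrefl e 0<k)
  zeroBelow (suc m) m<k = cong₂ _+_ (zeroBelow m (ℕₚ.<-trans (ℕₚ.n<1+n m) m<k)) (pointMass-≢ k v (λ e → ℕₚ.<-irrefl e m<k))
  go : ∀ m → k ≤ m → sumTo m (pointMass k v) ≡ v
  go zero z≤n = pointMass-≡ 0 v refl
  go (suc m) k≤1+m with ℕₚ.m≤n⇒m<n∨m≡n k≤1+m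
  ... | inj₁ (s≤s k≤m) = trans (cong₂ _+_ (go m k≤m) (pointMass-≢ k v (λ e → ℕₚ.<-irrefl (sym e) (s≤s k≤m)))) (ℕₚ.+-identityʳ v)
  ... | inj₂ refl = cong₂ _+_ (zeroBelow m ℕₚ.≤-refl) (pointMass-≡ (suc m) v refl)

cellWeight : ℕ → Diagram → ℕ → ℕ
cellWeight c E i with (i , c) ∈? E
... | yes _ = i
... | no _ = 0

cellWeight-∈ : ∀ {c E i} → (i , c) ∈ E → cellWeight c E i ≡ i
cellWeight-∈ {c} {E} {i} x∈ with (i , c) ∈? E
... | yes _ = refl
... | no x∉ = ⊥-elim (x∉ x∈)

cellWeight-∉ : ∀ {c E i} → (i , c) ∉ E → cellWeight c E i ≡ 0
cellWeight-∉ {c} {E} {i} x∉ with (i , c) ∈? E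
... | yes x∈ = ⊥-elim (x∉ x∈)
... | no _ = refl

cellWeight-cong : ∀ {c E F i} → ((i , c) ∈ E) ⇔ ((i , c) ∈ F) → cellWeight c E i ≡ cellWeight c F i
cellWeight-cong {c} {E} {F} {i} (to , from) with (i , c) ∈? E | (i , c) ∈? F
... | yes _ | yes _ = refl
... | no _ | no _ = refl
... | yes x∈ | no x∉ = ⊥-elim (x∉ (to x∈))
... | no x∉ | yes x∈ = ⊥-elim (x∉ (from x∈))

module Weights (R C : ℕ) where

  Bounded : Diagram → Set
  Bounded E = ∀ r c → (r , c) ∈ E → (r ≤ R) × (c ≤ C)

  weight : ℕ → Diagram → ℕ
  weight c E = sumTo R (cellWeight c E)

  potential : Diagram → ℕ
  potential E = sumTo C (λ c → weight c E)

  weight-cong : ∀ {c E F} → E ≐[ c ] F → weight c E ≡ weight c F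
  weight-cong e = sumTo-cong R (λ i _ → cellWeight-cong (e i))

  potential-cong : ∀ {E F} → E ≐ F → potential E ≡ potential F
  potential-cong e = sumTo-cong C (λ c _ → weight-cong (≐⇒≐[] e))

  bounded-resp-≐ : ∀ {E F} → E ≐ F → Bounded E → Bounded F
  bounded-resp-≐ e bE r c x∈ = bE r c (proj₂ (e _) x∈)

  module StepWeight {E F : Diagram} (s : KohnertStep E F) (bE : Bounded E) where
    open Step s

    bounded : Bounded F
    bounded i c x∈ with proj₁ (∈-result _) x∈
    ... | inj₁ (x∈E , _) = bE i c x∈E
    ... | inj₂ refl = ℕₚ.≤-trans (ℕₚ.<⇒≤ target<row) (proj₁ (bE _ _ cell∈)) , proj₂ (bE _ _ cell∈)

    otherColumn-weight : ∀ {c} → c ≢ col → weight c F ≡ weight c E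
    otherColumn-weight c≢ = sym (weight-cong (otherColumn c≢))

    -- The moved cell contributes row to the weight of E and target to that of F.
    movedColumn-weight : weight col F + row ≡ weight col E + target
    movedColumn-weight = begin
      weight col F + row                                      ≡⟨ cong (weight col F +_) (sym (sumTo-pointMass R row row row≤R)) ⟩
      weight col F + sumTo R (pointMass row row)              ≡⟨ sym (sumTo-+ R (cellWeight col F) _) ⟩
      sumTo R (λ i → cellWeight col F i + pointMass row row i) ≡⟨ sumTo-cong R (λ i _ → pointwise i) ⟩
      sumTo R (λ i → cellWeight col E i + pointMass target target i) ≡⟨ sumTo-+ R (cellWeight col E) _ ⟩
      weight col E + sumTo R (pointMass target target)        ≡⟨ cong (weight col E +_) (sumTo-pointMass R target target target≤R) ⟩
      weight col E + target                                   ∎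
      where
      open ≡-Reasoning
      row≤R : row ≤ R
      row≤R = proj₁ (bE _ _ cell∈)
      target≤R : target ≤ R
      target≤R = ℕₚ.≤-trans (ℕₚ.<⇒≤ target<row) row≤R
      untouched : ∀ {i} → i ≢ row → i ≢ target → ((i , col) ∈ F) ⇔ ((i , col) ∈ E)
      untouched {i} i≢r i≢t =
        (λ x∈ → Sum.[ proj₁ , (λ e → ⊥-elim (i≢t e)) ] (proj₁ (∈-movedColumn i) x∈)) ,
        (λ x∈ → proj₂ (∈-movedColumn i) (inj₁ (x∈ , i≢r)))

      pointwise : ∀ i → cellWeight col F i + pointMass row row i ≡ cellWeight col E i + pointMass target target i
      pointwise i = byCases (i ≟ row) (i ≟ target)
        where
        byCases : Dec (i ≡ row) → Dec (i ≡ target) →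
                  cellWeight col F i + pointMass row row i ≡ cellWeight col E i + pointMass target target i
        byCases (yes i≡r) (yes i≡t) = ⊥-elim (ℕₚ.<-irrefl (trans (sym i≡t) i≡r) target<row)
        byCases (yes refl) (no i≢t) = trans
          (cong₂ _+_ (cellWeight-∉ λ x∈ → Sum.[ (λ p → proj₂ p refl) , i≢t ] (proj₁ (∈-movedColumn i) x∈)) (pointMass-≡ row row refl))
          (sym (trans (cong₂ _+_ (cellWeight-∈ cell∈) (pointMass-≢ target target i≢t)) (ℕₚ.+-identityʳ i)))
        byCases (no i≢r) (yes refl) = trans
          (trans (cong₂ _+_ (cellWeight-∈ (proj₂ (∈-movedColumn i) (inj₂ refl))) (pointMass-≢ row row i≢r)) (ℕₚ.+-identityʳ i))
          (sym (cong₂ _+_ (cellWeight-∉ target∉) (pointMass-≡ target target refl)))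
        byCases (no i≢r) (no i≢t) =
          cong₂ _+_ (cellWeight-cong (untouched i≢r i≢t)) (trans (pointMass-≢ row row i≢r) (sym (pointMass-≢ target target i≢t)))

    movedColumn-weight-< : weight col F < weight col E
    movedColumn-weight-< = ℕₚ.+-cancelʳ-< row (weight col F) (weight col E)
      (subst (_< weight col E + row) (sym movedColumn-weight) (ℕₚ.+-monoʳ-< (weight col E) target<row))

    potential-< : potential F < potential E
    potential-< = sumTo-mono-< C col (proj₂ (bE _ _ cell∈)) weight-≤ movedColumn-weight-<
      where
      weight-≤ : ∀ c → c ≤ C → weight c F ≤ weight c E
      weight-≤ c _ with c ≟ col
      ... | yes refl = ℕₚ.<⇒≤ movedColumn-weight-<
      ... | no c≢ = ℕₚ.≤-reflexive (otherColumn-weight c≢)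

  reach-bounded : ∀ {E F} → Reach E F → Bounded E → Bounded F
  reach-bounded (done e) bE = bounded-resp-≐ e bE
  reach-bounded (step s r) bE = reach-bounded r (StepWeight.bounded s bE)

  weight-reach-≤ : ∀ c {E F} → Reach E F → Bounded E → weight c F ≤ weight c E
  weight-reach-≤ c (done e) bE = ℕₚ.≤-reflexive (weight-cong (≐[]-sym (≐⇒≐[] e)))
  weight-reach-≤ c (step s r) bE with c ≟ Step.col s
  ... | yes refl = ℕₚ.≤-trans (weight-reach-≤ c r (StepWeight.bounded s bE)) (ℕₚ.<⇒≤ (StepWeight.movedColumn-weight-< s bE))
  ... | no c≢ = ℕₚ.≤-trans (weight-reach-≤ c r (StepWeight.bounded s bE)) (ℕₚ.≤-reflexive (StepWeight.otherColumn-weight s bE c≢))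

  weight-reach-≡ : ∀ c {E F} → Reach E F → Bounded E → weight c F ≡ weight c E → E ≐[ c ] F
  weight-reach-≡ c (done e) bE _ = ≐⇒≐[] e
  weight-reach-≡ c (step s r) bE w≡ with c ≟ Step.col s
  ... | yes refl = ⊥-elim (ℕₚ.<-irrefl w≡
         (ℕₚ.≤-<-trans (weight-reach-≤ c r (StepWeight.bounded s bE)) (StepWeight.movedColumn-weight-< s bE)))
  ... | no c≢ = ≐[]-trans (Step.otherColumn s c≢)
         (weight-reach-≡ c r (StepWeight.bounded s bE) (trans w≡ (sym (StepWeight.otherColumn-weight s bE c≢))))

  weight-reach-sandwich : ∀ c {E F G} → Reach E F → Reach F G → Bounded E → weight c G ≡ weight c E → E ≐[ c ] F
  weight-reach-sandwich c E→F F→G bE w≡ = weight-reach-≡ c E→F bE (ℕₚ.≤-antisym (weight-reach-≤ c E→F bE)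
    (subst (_≤ weight c _) w≡ (weight-reach-≤ c F→G (reach-bounded E→F bE))))

  lower-weight : ∀ {E r c} (src∈ : (suc r , c) ∈ E) (rightmost : ∀ c' → (suc r , c') ∈ E → c' ≤ c) (1≤r : 1 ≤ r)
                 (tgt∉ : (r , c) ∉ E) → Bounded E → weight c (lower r c E) + 1 ≡ weight c E
  lower-weight {E} {r} {c} src∈ rightmost 1≤r tgt∉ bE = ℕₚ.+-cancelʳ-≡ r _ _
    (trans (ℕₚ.+-assoc _ 1 r) (StepWeight.movedColumn-weight (lower-step src∈ rightmost 1≤r tgt∉) bE))

  weight-<⇒¬reach : ∀ c {E F} → weight c E < weight c F → Bounded E → ¬ Reach E F
  weight-<⇒¬reach c E<F bE E→F = ℕₚ.<-irrefl refl (ℕₚ.<-≤-trans E<F (weight-reach-≤ c E→F bE))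

  weight-reach-trichotomy : ∀ c {E F G} → Reach E F → Reach F G → Bounded E →
                            E ≐[ c ] F ⊎ F ≐[ c ] G ⊎ ((weight c G < weight c F) × (weight c F < weight c E))
  weight-reach-trichotomy c {E} {F} {G} E→F F→G bE with weight c F ≟ weight c E | weight c G ≟ weight c F
  ... | yes F≡E | _ = inj₁ (weight-reach-≡ c E→F bE F≡E)
  ... | no _ | yes G≡F = inj₂ (inj₁ (weight-reach-≡ c F→G (reach-bounded E→F bE) G≡F))
  ... | no F≢E | no G≢F = inj₂ (inj₂ (ℕₚ.≤∧≢⇒< (weight-reach-≤ c F→G (reach-bounded E→F bE)) G≢F ,
                                      ℕₚ.≤∧≢⇒< (weight-reach-≤ c E→F bE) F≢E))

  -- Along a sequence of moves lowering the weight of column c by exactly one, exactly one cell of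
  -- column c went one row down, in a single move, made from some intermediate diagram.
  record UnitDrop (c : ℕ) (E F : Diagram) : Set where
    field
      row target : ℕ
      adjacent : suc target ≡ row
      row∈ : (row , c) ∈ E
      ∈-column : ∀ i → ((i , c) ∈ F) ⇔ ((((i , c) ∈ E) × (i ≢ row)) ⊎ (i ≡ target))
      middle : Diagram
      reach-middle : Reach E middle
      middle-reach : Reach middle F
      rightmost : ∀ c' → (row , c') ∈ middle → c' ≤ c

  unitDrop : ∀ c {E F} → Reach E F → Bounded E → weight c F + 1 ≡ weight c E → UnitDrop c E F
  unitDrop c (done e) bE w≡ = ⊥-elim (ℕₚ.<-irrefl
    (trans (sym (weight-cong (≐⇒≐[] e))) (trans (sym w≡) (ℕₚ.+-comm _ 1))) ℕₚ.≤-refl)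
  unitDrop c {E} {F} (step {E = E₁} s r) bE w≡ with c ≟ Step.col s
  ... | no c≢ = record
    { row = U.row ; target = U.target ; adjacent = U.adjacent
    ; row∈ = proj₂ (same U.row) U.row∈
    ; ∈-column = λ i → ⇔-trans (U.∈-column i) (before i)
    ; middle = U.middle ; reach-middle = step s U.reach-middle ; middle-reach = U.middle-reach ; rightmost = U.rightmost }
    where
    same : E ≐[ c ] E₁
    same = Step.otherColumn s c≢
    module U = UnitDrop (unitDrop c r (StepWeight.bounded s bE) (trans w≡ (sym (StepWeight.otherColumn-weight s bE c≢))))
    before : ∀ i → ((((i , c) ∈ E₁) × (i ≢ U.row)) ⊎ (i ≡ U.target)) ⇔ ((((i , c) ∈ E) × (i ≢ U.row)) ⊎ (i ≡ U.target))
    before i = Sum.map₁ (Product.map₁ (proj₂ (same i))) , Sum.map₁ (Product.map₁ (proj₁ (same i)))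
  ... | yes refl = record
    { row = row ; target = target ; adjacent = adjacent
    ; row∈ = cell∈
    ; ∈-column = λ i → ⇔-trans (⇔-sym (rest-fixes i)) (∈-movedColumn i)
    ; middle = E ; reach-middle = reach-refl ; middle-reach = step s r ; rightmost = rightmost }
    where
    open Step s
    open StepWeight s bE
    F≤E₁ : weight c F ≤ weight c E₁
    F≤E₁ = weight-reach-≤ c r bounded
    shifted : weight c E₁ + row ≡ weight c F + suc target
    shifted = begin
      weight c E₁ + row       ≡⟨ movedColumn-weight ⟩
      weight c E + target     ≡⟨ cong (_+ target) (sym w≡) ⟩
      weight c F + 1 + target ≡⟨ ℕₚ.+-assoc (weight c F) 1 target ⟩
      weight c F + suc target ∎
      where open ≡-Reasoning
    adjacent : suc target ≡ row
    adjacent = ℕₚ.≤-antisym target<row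
      (ℕₚ.+-cancelˡ-≤ (weight c E₁) _ _ (ℕₚ.≤-trans (ℕₚ.≤-reflexive shifted) (ℕₚ.+-monoˡ-≤ (suc target) F≤E₁)))
    rest-fixes : E₁ ≐[ c ] F
    rest-fixes = weight-reach-≡ c r bounded (ℕₚ.≤-antisym F≤E₁ (ℕₚ.≤-reflexive
      (ℕₚ.+-cancelʳ-≡ row _ _ (trans shifted (cong (weight c F +_) adjacent)))))

length-distinct-≤ : ∀ N {xs : List ℕ} → AllPairs _≢_ xs → All (_≤ N) xs → length xs ≤ suc N
length-distinct-≤ zero [] [] = z≤n
length-distinct-≤ zero (_ ∷ []) _ = s≤s z≤n
length-distinct-≤ zero ((x≢y ∷ _) ∷ _) (z≤n ∷ z≤n ∷ _) = ⊥-elim (x≢y refl)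
length-distinct-≤ (suc N) {xs} distinct xs≤ = ℕₚ.≤-trans (oneAbove distinct xs≤)
  (s≤s (length-distinct-≤ N (AllPairsₚ.filter⁺ (_≤? N) distinct) (Allₚ.all-filter (_≤? N) xs)))
  where
  -- At most one element, suc N, is dropped by the filter.
  oneAbove : ∀ {ys} → AllPairs _≢_ ys → All (_≤ suc N) ys → length ys ≤ suc (length (filter (_≤? N) ys))
  oneAbove [] [] = z≤n
  oneAbove {y ∷ ys} (y≢ys ∷ distinct) (y≤ ∷ ys≤) with y ≤? N
  ... | yes y≤N rewrite Listₚ.filter-accept (_≤? N) {xs = ys} y≤N = s≤s (oneAbove distinct ys≤)
  ... | no y≰N rewrite Listₚ.filter-reject (_≤? N) {xs = ys} y≰N =
    s≤s (ℕₚ.≤-reflexive (cong length (sym (Listₚ.filter-all (_≤? N) (All.zipWith below (y≢ys , ys≤))))))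
    where
    y≡ : y ≡ suc N
    y≡ = ℕₚ.≤-antisym y≤ (ℕₚ.≰⇒> y≰N)
    below : ∀ {z} → y ≢ z × z ≤ suc N → z ≤ N
    below (y≢z , z≤) with ℕₚ.m≤n⇒m<n∨m≡n z≤
    ... | inj₁ z<1+N = ℕₚ.≤-pred z<1+N
    ... | inj₂ z≡ = ⊥-elim (y≢z (trans y≡ (sym z≡)))

module _ {A : Set} where

  later-of-two : ∀ {P Q : A → Set} (xs : List A) → Any P xs → Any Q xs → (∀ {z} → P z → Q z → ⊥) →
                 ∃[ pre ] ∃[ z ] ∃[ post ] (xs ≡ pre ++ z ∷ post) × ((P z × Any Q pre) ⊎ (Q z × Any P pre))
  later-of-two (w ∷ xs) (here Pw) (here Qw) disjoint = ⊥-elim (disjoint Pw Qw)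
  later-of-two (w ∷ xs) (here Pw) (there Q∈xs) _ =
    let (z , z∈xs , Qz) = find Q∈xs ; (pre , post , xs≡) = ∈-∃++ z∈xs in
    w ∷ pre , z , post , cong (w ∷_) xs≡ , inj₂ (Qz , here Pw)
  later-of-two (w ∷ xs) (there P∈xs) (here Qw) _ =
    let (z , z∈xs , Pz) = find P∈xs ; (pre , post , xs≡) = ∈-∃++ z∈xs in
    w ∷ pre , z , post , cong (w ∷_) xs≡ , inj₁ (Pz , here Qw)
  later-of-two (w ∷ xs) (there P∈xs) (there Q∈xs) disjoint with later-of-two xs P∈xs Q∈xs disjoint
  ... | pre , z , post , xs≡ , found = w ∷ pre , z , post , cong (w ∷_) xs≡ , Sum.map (Product.map₂ there) (Product.map₂ there) found

  AllPairs-before : ∀ {R : A → A → Set} pre {z post} → AllPairs R (pre ++ z ∷ post) → ∀ {w} → w ∈ pre → R w z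
  AllPairs-before (w ∷ pre) (Rw ∷ _) (here refl) = All.lookup Rw (∈-++⁺ʳ pre (here refl))
  AllPairs-before (w ∷ pre) (_ ∷ R-rest) (there w∈pre) = AllPairs-before pre R-rest w∈pre

≐-decSetoid : DecSetoid 0ℓ 0ℓ
≐-decSetoid = record
  { Carrier = Diagram ; _≈_ = _≐_
  ; isDecEquivalence = record { isEquivalence = record { refl = ≐-refl ; sym = ≐-sym ; trans = ≐-trans } ; _≟_ = _≐?_ } }

≐-setoid : Setoid 0ℓ 0ℓ
≐-setoid = DecSetoid.setoid ≐-decSetoid

open import Data.List.Membership.DecSetoid ≐-decSetoid using () renaming (_∈?_ to _∈≐?_)

∈⇒∈≐ : ∀ {E L} → E ∈ L → E ∈≐ L
∈⇒∈≐ = Any.map λ { refl → ≐-refl }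

∈≐-resp-≐ : ∀ {E E' L} → E ≐ E' → E ∈≐ L → E' ∈≐ L
∈≐-resp-≐ = SetoidMembershipₚ.∈-resp-≈ ≐-setoid

find≐ : ∀ {E L} → E ∈≐ L → ∃[ F ] (F ∈ L) × (E ≐ F)
find≐ = find

⊆≐-lookup : ∀ {A B E} → A ⊆≐ B → E ∈≐ A → E ∈≐ B
⊆≐-lookup A⊆B E∈A = let (F , F∈A , E≐F) = find≐ E∈A in ∈≐-resp-≐ (≐-sym E≐F) (All.lookup A⊆B F∈A)

⊆≐-refl : ∀ {A} → A ⊆≐ A
⊆≐-refl = All.tabulate ∈⇒∈≐

⊆≐-trans : ∀ {A B C} → A ⊆≐ B → B ⊆≐ C → A ⊆≐ C
⊆≐-trans A⊆B B⊆C = All.tabulate λ E∈A → ⊆≐-lookup B⊆C (All.lookup A⊆B E∈A)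

⊈≐-witness : ∀ A B → ¬ (A ⊆≐ B) → ∃[ E ] (E ∈ A) × ¬ (E ∈≐ B)
⊈≐-witness [] B A⊈B = ⊥-elim (A⊈B [])
⊈≐-witness (E ∷ A) B A⊈B with E ∈≐? B
... | no E∉B = E , here refl , E∉B
... | yes E∈B = let (F , F∈A , F∉B) = ⊈≐-witness A B (λ A⊆B → A⊈B (E∈B ∷ A⊆B)) in F , there F∈A , F∉B

without : Diagram → List Diagram → List Diagram
without E = filter (λ F → ¬? (F ≐? E))

without-⊆ : ∀ E L → without E L SL.⊆ L
without-⊆ E L = SLₚ.filter-⊆ (λ F → ¬? (F ≐? E)) L

∈-without⁻ : ∀ {E F L} → F ∈ without E L → (F ∈ L) × ¬ (F ≐ E)
∈-without⁻ {E} = ∈-filter⁻ (λ F → ¬? (F ≐? E))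

∈≐-without⁺ : ∀ {E F L} → F ∈≐ L → ¬ (F ≐ E) → F ∈≐ without E L
∈≐-without⁺ {E} = SetoidMembershipₚ.∈-filter⁺ ≐-setoid (λ F → ¬? (F ≐? E)) (λ F≐G F≉E G≐E → F≉E (≐-trans F≐G G≐E))

∈≐-without⁻ : ∀ {E F L} → F ∈≐ without E L → (F ∈≐ L) × ¬ (F ≐ E)
∈≐-without⁻ {E} = SetoidMembershipₚ.∈-filter⁻ ≐-setoid (λ F → ¬? (F ≐? E)) (λ F≐G F≉E G≐E → F≉E (≐-trans F≐G G≐E))

without-mono : ∀ E {L M} → L ⊆≐ M → without E L ⊆≐ without E M
without-mono E L⊆M = All.tabulate λ F∈ → let (F∈L , F≉E) = ∈-without⁻ F∈ in ∈≐-without⁺ (All.lookup L⊆M F∈L) F≉E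

length-without : ∀ E {L} → AllPairs (λ F G → ¬ (F ≐ G)) L → E ∈≐ L → suc (length (without E L)) ≡ length L
length-without E {F ∷ L} (F≉L ∷ distinct) (here E≐F) with F ≐? E
... | no F≉E = ⊥-elim (F≉E (≐-sym E≐F))
... | yes _ = cong (suc ∘ length) (Listₚ.filter-all (λ G → ¬? (G ≐? E))
                (All.map (λ F≉G G≐E → F≉G (≐-trans (≐-sym E≐F) (≐-sym G≐E))) F≉L))
length-without E {F ∷ L} (F≉L ∷ distinct) (there E∈L) with F ≐? E
... | yes F≐E = let (G , G∈L , E≐G) = find≐ E∈L in ⊥-elim (All.lookup F≉L G∈L (≐-trans F≐E E≐G))
... | no _ = cong suc (length-without E distinct E∈L)

module KohnertPoset (D : Diagram) (rank : Diagram → ℕ)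
  (rank-cong : ∀ {E F} → E ≐ F → rank E ≡ rank F)
  (rank-step : ∀ {E F} → Reach D E → KohnertStep E F → rank F < rank E) where

  rank-reach-≤ : ∀ {E F} → Reach D E → Reach E F → rank F ≤ rank E
  rank-reach-≤ D→E (done e) = ℕₚ.≤-reflexive (sym (rank-cong e))
  rank-reach-≤ D→E (step s r) = ℕₚ.≤-trans (rank-reach-≤ (reach-trans D→E (reach-step s)) r) (ℕₚ.<⇒≤ (rank-step D→E s))

  rank-reach-< : ∀ {E F} → Reach D E → Reach E F → ¬ (E ≐ F) → rank F < rank E
  rank-reach-< D→E (done e) E≉F = ⊥-elim (E≉F e)
  rank-reach-< D→E (step s r) _ = ℕₚ.≤-<-trans (rank-reach-≤ (reach-trans D→E (reach-step s)) r) (rank-step D→E s)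

  rank-≢⇒≉ : ∀ {E F} → rank E ≢ rank F → ¬ (E ≐ F)
  rank-≢⇒≉ r≢ e = r≢ (rank-cong e)

  Comparable : Diagram → Diagram → Set
  Comparable E F = Reach E F ⊎ Reach F E

  comparable-refl : ∀ {E} → Comparable E E
  comparable-refl = inj₁ reach-refl

  comparable-sym : ∀ {E F} → Comparable E F → Comparable F E
  comparable-sym = Sum.swap

  comparable-resp-≐ : ∀ {E E' F F'} → E ≐ E' → F ≐ F' → Comparable E F → Comparable E' F'
  comparable-resp-≐ e f (inj₁ r) = inj₁ (reach-resp-≐ e f r)
  comparable-resp-≐ e f (inj₂ r) = inj₂ (reach-resp-≐ f e r)

  chain-reach : ∀ {L} → IsChain D L → ∀ {E} → E ∈≐ L → Reach D E
  chain-reach (reach , _) E∈L = let (F , F∈L , E≐F) = find≐ E∈L in reach-resp-≐ ≐-refl (≐-sym E≐F) (All.lookup reach F∈L)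

  chain-comparable : ∀ {L} → IsChain D L → ∀ {E F} → E ∈≐ L → F ∈≐ L → Comparable E F
  chain-comparable (_ , comparable , _) E∈L F∈L =
    let (E' , E'∈L , E≐E') = find≐ E∈L ; (F' , F'∈L , F≐F') = find≐ F∈L in
    comparable-resp-≐ (≐-sym E≐E') (≐-sym F≐F') (pairwise comparable E'∈L F'∈L)
    where
    pairwise : ∀ {L} → AllPairs Comparable L → ∀ {E F} → E ∈ L → F ∈ L → Comparable E F
    pairwise (_ ∷ _) (here refl) (here refl) = comparable-refl
    pairwise (E~L ∷ _) (here refl) (there F∈L) = All.lookup E~L F∈L
    pairwise (E~L ∷ _) (there E∈L) (here refl) = comparable-sym (All.lookup E~L E∈L)
    pairwise (_ ∷ L~L) (there E∈L) (there F∈L) = pairwise L~L E∈L F∈L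

  chain-∷ : ∀ {L E} → IsChain D L → Reach D E → (∀ {F} → F ∈ L → Comparable E F) → ¬ (E ∈≐ L) → IsChain D (E ∷ L)
  chain-∷ (reach , comparable , distinct) D→E E~L E∉L =
    D→E ∷ reach , All.tabulate E~L ∷ comparable ,
    All.tabulate (λ F∈L E≐F → E∉L (∈≐-resp-≐ (≐-sym E≐F) (∈⇒∈≐ F∈L))) ∷ distinct

  chain-without : ∀ {L} E → IsChain D L → IsChain D (without E L)
  chain-without E (reach , comparable , distinct) =
    Allₚ.filter⁺ (λ F → ¬? (F ≐? E)) reach , AllPairsₚ.filter⁺ (λ F → ¬? (F ≐? E)) comparable ,
    AllPairsₚ.filter⁺ (λ F → ¬? (F ≐? E)) distinct

  -- The ranks of the elements of a chain are distinct and at most rank D.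
  chain-length : ∀ {L} → IsChain D L → length L ≤ suc (rank D)
  chain-length {L} (reach , comparable , distinct) = subst (_≤ suc (rank D)) (Listₚ.length-map rank L)
    (length-distinct-≤ (rank D) (AllPairsₚ.map⁺ (distinctRanks reach comparable distinct))
                                (Allₚ.map⁺ (All.map (rank-reach-≤ reach-refl) reach)))
    where
    distinctRanks : ∀ {L} → All (Reach D) L → AllPairs Comparable L → AllPairs (λ E F → ¬ (E ≐ F)) L →
                    AllPairs (λ E F → rank E ≢ rank F) L
    distinctRanks [] [] [] = []
    distinctRanks (D→E ∷ reach) (E~L ∷ comparable) (E≉L ∷ distinct) =
      All.zipWith ranks≢ (reach , All.zipWith (λ x → x) (E~L , E≉L)) ∷ distinctRanks reach comparable distinct
      where
      ranks≢ : ∀ {F} → Reach D F × Comparable _ F × ¬ (_ ≐ F) → rank _ ≢ rank F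
      ranks≢ (D→F , inj₁ E→F , E≉F) r≡ = ℕₚ.<-irrefl (sym r≡) (rank-reach-< D→E E→F E≉F)
      ranks≢ (D→F , inj₂ F→E , E≉F) r≡ = ℕₚ.<-irrefl r≡ (rank-reach-< D→F F→E (λ F≐E → E≉F (≐-sym F≐E)))

  -- Maximality of a chain is not decidable, hence the double negation; n bounds how often the chain can still grow.
  extend-to-facet : ∀ n {C} → IsChain D C → suc (suc (rank D)) ≤ length C + n → ¬ ¬ (∃[ F ] IsFacet D F × (C ⊆≐ F))
  extend-to-facet zero {C} chain bound _ =
    ℕₚ.<-irrefl refl (ℕₚ.≤-trans (subst (suc (suc (rank D)) ≤_) (ℕₚ.+-identityʳ (length C)) bound) (chain-length chain))
  extend-to-facet (suc n) {C} chain bound noFacet = noFacet (C , (chain , maximal) , ⊆≐-refl)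
    where
    maximal : ∀ G → IsChain D G → C ⊆≐ G → G ⊆≐ C
    maximal G chainG C⊆G with All.all? (_∈≐? C) G
    ... | yes G⊆C = G⊆C
    ... | no G⊈C = let (g , g∈G , g∉C) = ⊈≐-witness G C G⊈C in ⊥-elim (extend-to-facet n
            (chain-∷ chain (chain-reach chainG (∈⇒∈≐ g∈G)) (λ F∈C → chain-comparable chainG (∈⇒∈≐ g∈G) (All.lookup C⊆G F∈C)) g∉C)
            (subst (suc (suc (rank D)) ≤_) (ℕₚ.+-suc (length C) n) bound)
            λ { (F , facet , _ ∷ C⊆F) → noFacet (F , facet , C⊆F) })

  chain-in-facet : ∀ {C} → IsChain D C → ¬ ¬ (∃[ F ] IsFacet D F × (C ⊆≐ F))
  chain-in-facet {C} chain = extend-to-facet (suc (suc (rank D))) chain (ℕₚ.m≤n+m _ (length C))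

  facet-absorbs : ∀ {F q} → IsFacet D F → Reach D q → (∀ {f} → f ∈ F → Comparable q f) → q ∈≐ F
  facet-absorbs {F} {q} (chain , maximal) D→q q~F with q ∈≐? F
  ... | yes q∈F = q∈F
  ... | no q∉F with maximal (q ∷ F) (chain-∷ chain D→q q~F q∉F) (All.tabulate λ f∈F → there (∈⇒∈≐ f∈F))
  ...   | q∈F ∷ _ = ⊥-elim (q∉F q∈F)

  record SplitInterval (y x p₁ p₂ q₁ q₂ : Diagram) : Set where
    field
      reach-top : Reach D y
      y→p₁ : Reach y p₁
      p₁→p₂ : Reach p₁ p₂
      p₂→x : Reach p₂ x
      y→q₁ : Reach y q₁
      q₁→q₂ : Reach q₁ q₂
      q₂→x : Reach q₂ x
      p₁<y : rank p₁ < rank y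
      p₂<p₁ : rank p₂ < rank p₁
      x<p₂ : rank x < rank p₂
      q₁<y : rank q₁ < rank y
      q₂<q₁ : rank q₂ < rank q₁
      x<q₂ : rank x < rank q₂
      incomparable : ∀ {u v} → (u ≡ p₁ ⊎ u ≡ p₂) → (v ≡ q₁ ⊎ v ≡ q₂) → ¬ Comparable u v
      interval : ∀ z → Reach y z → Reach z x → (z ≐ y) ⊎ (z ≐ x) ⊎ (z ≐ p₁) ⊎ (z ≐ p₂) ⊎ (z ≐ q₁) ⊎ (z ≐ q₂)

  flip : ∀ {y x p₁ p₂ q₁ q₂} → SplitInterval y x p₁ p₂ q₁ q₂ → SplitInterval y x q₁ q₂ p₁ p₂
  flip I = record
    { reach-top = reach-top
    ; y→p₁ = y→q₁ ; p₁→p₂ = q₁→q₂ ; p₂→x = q₂→x ; y→q₁ = y→p₁ ; q₁→q₂ = p₁→p₂ ; q₂→x = p₂→x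
    ; p₁<y = q₁<y ; p₂<p₁ = q₂<q₁ ; x<p₂ = x<q₂ ; q₁<y = p₁<y ; q₂<q₁ = p₂<p₁ ; x<q₂ = x<p₂
    ; incomparable = λ u v u~v → incomparable v u (comparable-sym u~v)
    ; interval = λ z y→z z→x → reorder (interval z y→z z→x) }
    where
    open SplitInterval I
    reorder : ∀ {A B C E F G} → A ⊎ B ⊎ C ⊎ E ⊎ F ⊎ G → A ⊎ B ⊎ F ⊎ G ⊎ C ⊎ E
    reorder = Sum.map₂ (Sum.map₂ Sum.[ inj₂ ∘ inj₂ ∘ inj₁ , Sum.[ inj₂ ∘ inj₂ ∘ inj₂ , Sum.[ inj₁ , inj₂ ∘ inj₁ ] ] ])

  module SplitChains {y x p₁ p₂ q₁ q₂ : Diagram} (I : SplitInterval y x p₁ p₂ q₁ q₂) where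
    open SplitInterval I

    Outside : Diagram → Set
    Outside f = Reach f y ⊎ Reach x f

    StrictlyInside : Diagram → Set
    StrictlyInside g = Reach y g × Reach g x × rank g < rank y × rank x < rank g

    inside-p₁ : StrictlyInside p₁
    inside-p₁ = y→p₁ , reach-trans p₁→p₂ p₂→x , p₁<y , ℕₚ.<-trans x<p₂ p₂<p₁

    inside-p₂ : StrictlyInside p₂
    inside-p₂ = reach-trans y→p₁ p₁→p₂ , p₂→x , ℕₚ.<-trans p₂<p₁ p₁<y , x<p₂

    inside-q₁ : StrictlyInside q₁
    inside-q₁ = y→q₁ , reach-trans q₁→q₂ q₂→x , q₁<y , ℕₚ.<-trans x<q₂ q₂<q₁

    inside-q₂ : StrictlyInside q₂
    inside-q₂ = reach-trans y→q₁ q₁→q₂ , q₂→x , ℕₚ.<-trans q₂<q₁ q₁<y , x<q₂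

    outside-y : Outside y
    outside-y = inj₁ reach-refl

    outside-x : Outside x
    outside-x = inj₂ reach-refl

    outside-resp-≐ : ∀ {f g} → f ≐ g → Outside f → Outside g
    outside-resp-≐ f≐g (inj₁ f→y) = inj₁ (reach-resp-≐ f≐g ≐-refl f→y)
    outside-resp-≐ f≐g (inj₂ x→f) = inj₂ (reach-resp-≐ ≐-refl f≐g x→f)

    outside-comparable : ∀ {f g} → Outside f → StrictlyInside g → Comparable f g
    outside-comparable (inj₁ f→y) (y→g , _) = inj₁ (reach-trans f→y y→g)
    outside-comparable (inj₂ x→f) (_ , g→x , _) = inj₂ (reach-trans g→x x→f)

    outside-≉ : ∀ {f g} → Outside f → StrictlyInside g → ¬ (f ≐ g)
    outside-≉ f-out (y→g , g→x , g<y , x<g) f≐g with outside-resp-≐ f≐g f-out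
    ... | inj₁ g→y = ℕₚ.<-irrefl refl (ℕₚ.<-≤-trans g<y (rank-reach-≤ (reach-trans reach-top y→g) g→y))
    ... | inj₂ x→g = ℕₚ.<-irrefl refl (ℕₚ.<-≤-trans x<g (rank-reach-≤ (reach-trans reach-top (reach-trans y→g g→x)) x→g))

    p₁≉p₂ : ¬ (p₁ ≐ p₂)
    p₁≉p₂ = rank-≢⇒≉ λ r≡ → ℕₚ.<-irrefl (sym r≡) p₂<p₁

    classify : ∀ {f} → Comparable f y → Comparable f x → Outside f ⊎ (f ≐ p₁) ⊎ (f ≐ p₂) ⊎ (f ≐ q₁) ⊎ (f ≐ q₂)
    classify (inj₁ f→y) _ = inj₁ (inj₁ f→y)
    classify (inj₂ y→f) (inj₂ x→f) = inj₁ (inj₂ x→f)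
    classify {f} (inj₂ y→f) (inj₁ f→x) with interval f y→f f→x
    ... | inj₁ f≐y = inj₁ (inj₁ (done f≐y))
    ... | inj₂ (inj₁ f≐x) = inj₁ (inj₂ (done (≐-sym f≐x)))
    ... | inj₂ (inj₂ f≐) = inj₂ f≐

    q-incomparable-p : ∀ {v f} → (v ≡ q₁ ⊎ v ≡ q₂) → f ≐ v → ¬ (Comparable f p₁ ⊎ Comparable f p₂)
    q-incomparable-p v≡ f≐v (inj₁ f~p₁) = incomparable (inj₁ refl) v≡ (comparable-resp-≐ ≐-refl f≐v (comparable-sym f~p₁))
    q-incomparable-p v≡ f≐v (inj₂ f~p₂) = incomparable (inj₂ refl) v≡ (comparable-resp-≐ ≐-refl f≐v (comparable-sym f~p₂))

    near-p : ∀ {f} → Comparable f y → Comparable f x → Comparable f p₁ ⊎ Comparable f p₂ → Outside f ⊎ (f ≐ p₁) ⊎ (f ≐ p₂)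
    near-p f~y f~x f~p with classify f~y f~x
    ... | inj₁ f-out = inj₁ f-out
    ... | inj₂ (inj₁ f≐p₁) = inj₂ (inj₁ f≐p₁)
    ... | inj₂ (inj₂ (inj₁ f≐p₂)) = inj₂ (inj₂ f≐p₂)
    ... | inj₂ (inj₂ (inj₂ (inj₁ f≐q₁))) = ⊥-elim (q-incomparable-p (inj₁ refl) f≐q₁ f~p)
    ... | inj₂ (inj₂ (inj₂ (inj₂ f≐q₂))) = ⊥-elim (q-incomparable-p (inj₂ refl) f≐q₂ f~p)

    comparable-both-p : ∀ {f} → Comparable f y → Comparable f x → Comparable f p₁ ⊎ Comparable f p₂ →
                        Comparable f p₁ × Comparable f p₂
    comparable-both-p f~y f~x f~p with near-p f~y f~x f~p
    ... | inj₁ f-out = outside-comparable f-out inside-p₁ , outside-comparable f-out inside-p₂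
    ... | inj₂ (inj₁ f≐p₁) = comparable-resp-≐ (≐-sym f≐p₁) ≐-refl comparable-refl ,
                             comparable-resp-≐ (≐-sym f≐p₁) ≐-refl (inj₁ p₁→p₂)
    ... | inj₂ (inj₂ f≐p₂) = comparable-resp-≐ (≐-sym f≐p₂) ≐-refl (inj₂ p₁→p₂) ,
                             comparable-resp-≐ (≐-sym f≐p₂) ≐-refl comparable-refl

    facet-has-both-p : ∀ {F} → IsFacet D F → y ∈≐ F → x ∈≐ F → p₁ ∈≐ F ⊎ p₂ ∈≐ F → p₁ ∈≐ F × p₂ ∈≐ F
    facet-has-both-p {F} facet y∈F x∈F p∈F =
      facet-absorbs facet (reach-trans reach-top y→p₁) (λ f∈F → comparable-sym (proj₁ (both f∈F))) ,
      facet-absorbs facet (reach-trans reach-top (reach-trans y→p₁ p₁→p₂)) (λ f∈F → comparable-sym (proj₂ (both f∈F)))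
      where
      chain : IsChain D F
      chain = proj₁ facet
      both : ∀ {f} → f ∈ F → Comparable f p₁ × Comparable f p₂
      both f∈F = comparable-both-p (chain-comparable chain (∈⇒∈≐ f∈F) y∈F) (chain-comparable chain (∈⇒∈≐ f∈F) x∈F)
        (Sum.map (chain-comparable chain (∈⇒∈≐ f∈F)) (chain-comparable chain (∈⇒∈≐ f∈F)) p∈F)

    swap : List Diagram → List Diagram
    swap L = q₁ ∷ q₂ ∷ without p₂ (without p₁ L)

    swap-chain : ∀ {L} → IsChain D L → p₁ ∈≐ L → y ∈≐ L → x ∈≐ L → IsChain D (swap L)
    swap-chain {L} chain p₁∈L y∈L x∈L =
      chain-∷ (chain-∷ (chain-without p₂ (chain-without p₁ chain)) (reach-trans reach-top (proj₁ inside-q₂))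
          (λ f∈ → comparable-sym (outside-comparable (rest-outside f∈) inside-q₂)) (rest-∌ inside-q₂))
        (reach-trans reach-top y→q₁) q₁~ q₁∉
      where
      rest : List Diagram
      rest = without p₂ (without p₁ L)
      rest-outside : ∀ {f} → f ∈ rest → Outside f
      rest-outside f∈ with ∈-without⁻ f∈
      ... | f∈' , f≉p₂ with ∈-without⁻ f∈'
      ...   | f∈L , f≉p₁ with near-p (chain-comparable chain (∈⇒∈≐ f∈L) y∈L) (chain-comparable chain (∈⇒∈≐ f∈L) x∈L)
                                   (inj₁ (chain-comparable chain (∈⇒∈≐ f∈L) p₁∈L))
      ...     | inj₁ f-out = f-out
      ...     | inj₂ (inj₁ f≐p₁) = ⊥-elim (f≉p₁ f≐p₁)
      ...     | inj₂ (inj₂ f≐p₂) = ⊥-elim (f≉p₂ f≐p₂)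
      rest-∌ : ∀ {g} → StrictlyInside g → ¬ (g ∈≐ rest)
      rest-∌ g-in g∈ = let (f , f∈ , g≐f) = find≐ g∈ in outside-≉ (rest-outside f∈) g-in (≐-sym g≐f)
      q₁~ : ∀ {f} → f ∈ q₂ ∷ rest → Comparable q₁ f
      q₁~ (here refl) = inj₁ q₁→q₂
      q₁~ (there f∈) = comparable-sym (outside-comparable (rest-outside f∈) inside-q₁)
      q₁∉ : ¬ (q₁ ∈≐ (q₂ ∷ rest))
      q₁∉ (here q₁≐q₂) = rank-≢⇒≉ (λ r≡ → ℕₚ.<-irrefl (sym r≡) q₂<q₁) q₁≐q₂
      q₁∉ (there q₁∈) = rest-∌ inside-q₁ q₁∈

    -- In a shelling, removing p₁ and p₂ from a facet listed after one containing the rest of it leaves a maximal face of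
    -- the intersection complex that has codimension 2, not 1.
    not-pure-after : ∀ {Fk pre} → IsFacet D Fk → p₁ ∈≐ Fk → p₂ ∈≐ Fk → y ∈≐ Fk → x ∈≐ Fk →
                     All (IsFacet D) pre → (∀ {Fj} → Fj ∈ pre → ¬ (Fj ≈F Fk)) →
                     Any (without p₂ (without p₁ Fk) ⊆≐_) pre → ¬ PureCodim1 pre Fk
    not-pure-after {Fk} {pre} facetK p₁∈K p₂∈K y∈K x∈K facets distinct earlier pure =
      ℕₚ.<-irrefl (trans (pure G (SL.⊆-trans (without-⊆ p₂ _) (without-⊆ p₁ Fk) , earlier) G-maximal)
                         (sym (trans (cong suc length-G) length-without-p₁))) ℕₚ.≤-refl
      where
      G : List Diagram
      G = without p₂ (without p₁ Fk)
      distinctK : AllPairs (λ E F → ¬ (E ≐ F)) Fk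
      distinctK = proj₂ (proj₂ (proj₁ facetK))
      length-without-p₁ : suc (length (without p₁ Fk)) ≡ length Fk
      length-without-p₁ = length-without p₁ distinctK p₁∈K
      length-G : suc (length G) ≡ length (without p₁ Fk)
      length-G = length-without p₂ (AllPairsₚ.filter⁺ (λ F → ¬? (F ≐? p₁)) distinctK)
                   (∈≐-without⁺ p₂∈K (λ p₂≐p₁ → p₁≉p₂ (≐-sym p₂≐p₁)))
      ∈G : ∀ {f} → f ∈≐ Fk → ¬ (f ≐ p₁) → ¬ (f ≐ p₂) → f ∈≐ G
      ∈G f∈K f≉p₁ f≉p₂ = ∈≐-without⁺ (∈≐-without⁺ f∈K f≉p₁) f≉p₂
      K⊆ : ∀ {M} → G ⊆≐ M → p₁ ∈≐ M → p₂ ∈≐ M → Fk ⊆≐ M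
      K⊆ {M} G⊆M p₁∈M p₂∈M = All.tabulate λ {f} f∈K → byCases (∈⇒∈≐ f∈K) (f ≐? p₁) (f ≐? p₂)
        where
        byCases : ∀ {f} → f ∈≐ Fk → Dec (f ≐ p₁) → Dec (f ≐ p₂) → f ∈≐ M
        byCases _ (yes f≐p₁) _ = ∈≐-resp-≐ (≐-sym f≐p₁) p₁∈M
        byCases _ (no _) (yes f≐p₂) = ∈≐-resp-≐ (≐-sym f≐p₂) p₂∈M
        byCases f∈K (no f≉p₁) (no f≉p₂) = ⊆≐-lookup G⊆M (∈G f∈K f≉p₁ f≉p₂)
      y∈G : y ∈≐ G
      y∈G = ∈G y∈K (outside-≉ outside-y inside-p₁) (outside-≉ outside-y inside-p₂)
      x∈G : x ∈≐ G
      x∈G = ∈G x∈K (outside-≉ outside-x inside-p₁) (outside-≉ outside-x inside-p₂)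
      earlier-without-p : ∀ {Fj} → Fj ∈ pre → G ⊆≐ Fj → ¬ (p₁ ∈≐ Fj ⊎ p₂ ∈≐ Fj)
      earlier-without-p {Fj} Fj∈ G⊆Fj p∈Fj = distinct Fj∈ (Fj⊆K , K⊆Fj)
        where
        facetJ : IsFacet D Fj
        facetJ = All.lookup facets Fj∈
        both : p₁ ∈≐ Fj × p₂ ∈≐ Fj
        both = facet-has-both-p facetJ (⊆≐-lookup G⊆Fj y∈G) (⊆≐-lookup G⊆Fj x∈G) p∈Fj
        K⊆Fj : Fk ⊆≐ Fj
        K⊆Fj = K⊆ G⊆Fj (proj₁ both) (proj₂ both)
        Fj⊆K : Fj ⊆≐ Fk
        Fj⊆K = proj₂ facetK Fj (proj₁ facetJ) K⊆Fj
      G-maximal : ∀ G' → InΔ pre Fk G' → G ⊆≐ G' → G' ⊆≐ G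
      G-maximal G' (G'⊆K , G'-earlier) G⊆G' with find G'-earlier
      ... | Fj , Fj∈ , G'⊆Fj = All.tabulate λ {g} g∈G' → byCases (∈⇒∈≐ (SL.lookup G'⊆K g∈G')) (g ≐? p₁) (g ≐? p₂) g∈G'
        where
        excluded : ∀ {g} → g ∈ G' → ∀ {p} → g ≐ p → (p ∈≐ Fj → p₁ ∈≐ Fj ⊎ p₂ ∈≐ Fj) → ⊥
        excluded g∈G' g≐p inj = earlier-without-p Fj∈ (⊆≐-trans G⊆G' G'⊆Fj) (inj (∈≐-resp-≐ g≐p (All.lookup G'⊆Fj g∈G')))
        byCases : ∀ {g} → g ∈≐ Fk → Dec (g ≐ p₁) → Dec (g ≐ p₂) → g ∈ G' → g ∈≐ G
        byCases _ (yes g≐p₁) _ g∈G' = ⊥-elim (excluded g∈G' g≐p₁ inj₁)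
        byCases _ (no _) (yes g≐p₂) g∈G' = ⊥-elim (excluded g∈G' g≐p₂ inj₂)
        byCases g∈K (no g≉p₁) (no g≉p₂) _ = ∈G g∈K g≉p₁ g≉p₂

    ∈≐-swap : ∀ {L f} → f ∈≐ L → ¬ (f ≐ p₁) → ¬ (f ≐ p₂) → f ∈≐ swap L
    ∈≐-swap f∈L f≉p₁ f≉p₂ = there (there (∈≐-without⁺ (∈≐-without⁺ f∈L f≉p₁) f≉p₂))

    without-⊆≐-swap : ∀ L → without p₂ (without p₁ L) ⊆≐ swap L
    without-⊆≐-swap L = All.tabulate λ f∈ → there (there (∈⇒∈≐ f∈))

    swap-without-⊆≐ : ∀ L → without q₂ (without q₁ (swap L)) ⊆≐ L
    swap-without-⊆≐ L = All.tabulate λ f∈ → let (f∈' , f≉q₂) = ∈-without⁻ f∈ ; (f∈swap , f≉q₁) = ∈-without⁻ f∈' in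
      back f∈swap f≉q₁ f≉q₂
      where
      back : ∀ {f} → f ∈ swap L → ¬ (f ≐ q₁) → ¬ (f ≐ q₂) → f ∈≐ L
      back (here refl) f≉q₁ _ = ⊥-elim (f≉q₁ ≐-refl)
      back (there (here refl)) _ f≉q₂ = ⊥-elim (f≉q₂ ≐-refl)
      back (there (there f∈)) _ _ = ∈⇒∈≐ (proj₁ (∈-without⁻ (proj₁ (∈-without⁻ f∈))))

  module SplitFacets {y x p₁ p₂ q₁ q₂ : Diagram} (I : SplitInterval y x p₁ p₂ q₁ q₂) where
    open SplitInterval I
    open SplitChains I
    module Q = SplitChains (flip I)

    swap-facet : ∀ {A} → IsFacet D A → p₁ ∈≐ A → p₂ ∈≐ A → y ∈≐ A → x ∈≐ A → IsFacet D (swap A)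
    swap-facet {A} (chainA , maximalA) p₁∈A p₂∈A y∈A x∈A = swap-chain chainA p₁∈A y∈A x∈A , maximal
      where
      maximal : ∀ G → IsChain D G → swap A ⊆≐ G → G ⊆≐ swap A
      maximal G chainG B⊆G = All.tabulate λ {g} g∈G → byCases (∈⇒∈≐ g∈G) (g ≐? q₁) (g ≐? q₂)
        where
        q₁∈G : q₁ ∈≐ G
        q₁∈G = ⊆≐-lookup B⊆G (here ≐-refl)
        y∈G : y ∈≐ G
        y∈G = ⊆≐-lookup B⊆G (∈≐-swap y∈A (outside-≉ outside-y inside-p₁) (outside-≉ outside-y inside-p₂))
        x∈G : x ∈≐ G
        x∈G = ⊆≐-lookup B⊆G (∈≐-swap x∈A (outside-≉ outside-x inside-p₁) (outside-≉ outside-x inside-p₂))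
        A⊆G' : A ⊆≐ Q.swap G
        A⊆G' = All.tabulate λ {f} f∈A → fromA (∈⇒∈≐ f∈A) (f ≐? p₁) (f ≐? p₂)
          where
          fromA : ∀ {f} → f ∈≐ A → Dec (f ≐ p₁) → Dec (f ≐ p₂) → f ∈≐ Q.swap G
          fromA _ (yes f≐p₁) _ = here f≐p₁
          fromA _ (no _) (yes f≐p₂) = there (here f≐p₂)
          fromA f∈A (no f≉p₁) (no f≉p₂) = Q.∈≐-swap (⊆≐-lookup B⊆G (∈≐-swap f∈A f≉p₁ f≉p₂))
            (λ f≐q₁ → q-incomparable-p (inj₁ refl) f≐q₁ (inj₁ (chain-comparable chainA f∈A p₁∈A)))
            (λ f≐q₂ → q-incomparable-p (inj₂ refl) f≐q₂ (inj₁ (chain-comparable chainA f∈A p₁∈A)))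
        G'⊆A : Q.swap G ⊆≐ A
        G'⊆A = maximalA (Q.swap G) (Q.swap-chain chainG q₁∈G y∈G x∈G) A⊆G'
        byCases : ∀ {g} → g ∈≐ G → Dec (g ≐ q₁) → Dec (g ≐ q₂) → g ∈≐ swap A
        byCases _ (yes g≐q₁) _ = here g≐q₁
        byCases _ (no _) (yes g≐q₂) = there (here g≐q₂)
        byCases g∈G (no g≉q₁) (no g≉q₂) = ∈≐-swap (⊆≐-lookup G'⊆A (Q.∈≐-swap g∈G g≉q₁ g≉q₂))
          (λ g≐p₁ → Q.q-incomparable-p (inj₁ refl) g≐p₁ (inj₁ (chain-comparable chainG g∈G q₁∈G)))
          (λ g≐p₂ → Q.q-incomparable-p (inj₂ refl) g≐p₂ (inj₁ (chain-comparable chainG g∈G q₁∈G)))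

    top-chain : IsChain D (y ∷ p₁ ∷ p₂ ∷ x ∷ [])
    top-chain =
      chain-∷ (chain-∷ (chain-∷ (chain-∷ ([] , [] , []) D→x (λ ()) (λ ()))
        D→p₂ (λ { (here refl) → inj₁ p₂→x })
             (λ { (here p₂≐x) → outside-≉ outside-x inside-p₂ (≐-sym p₂≐x) }))
        D→p₁ (λ { (here refl) → inj₁ p₁→p₂ ; (there (here refl)) → inj₁ (reach-trans p₁→p₂ p₂→x) })
             (λ { (here p₁≐p₂) → p₁≉p₂ p₁≐p₂ ; (there (here p₁≐x)) → outside-≉ outside-x inside-p₁ (≐-sym p₁≐x) }))
        reach-top (λ { (here refl) → inj₁ y→p₁ ; (there (here refl)) → inj₁ (proj₁ inside-p₂)
                     ; (there (there (here refl))) → inj₁ (reach-trans y→p₁ (reach-trans p₁→p₂ p₂→x)) })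
                  (λ { (here y≐p₁) → outside-≉ outside-y inside-p₁ y≐p₁
                     ; (there (here y≐p₂)) → outside-≉ outside-y inside-p₂ y≐p₂
                     ; (there (there (here y≐x))) →
                         rank-≢⇒≉ (λ r≡ → ℕₚ.<-irrefl (sym r≡) (ℕₚ.<-trans (ℕₚ.<-trans x<p₂ p₂<p₁) p₁<y)) y≐x })
      where
      D→p₁ : Reach D p₁
      D→p₁ = reach-trans reach-top y→p₁
      D→p₂ : Reach D p₂
      D→p₂ = reach-trans D→p₁ p₁→p₂
      D→x : Reach D x
      D→x = reach-trans D→p₂ p₂→x

    split⇒¬shellable : ¬ KohnertShellable D
    split⇒¬shellable (Fs , facets , complete , distinct , shelling) =
      chain-in-facet top-chain λ { (A , facetA , A⊇top) → from-facet A facetA A⊇top }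
      where
      position : ∀ {P : List Diagram → Set} pre Fk post → Fs ≡ pre ++ Fk ∷ post → Any P pre →
                 IsFacet D Fk × All (IsFacet D) pre × (∀ {Fj} → Fj ∈ pre → ¬ (Fj ≈F Fk)) × PureCodim1 pre Fk
      position pre Fk post Fs≡ earlier =
        let (facets-pre , facets-rest) = Allₚ.++⁻ pre (subst (All (IsFacet D)) Fs≡ facets) in
        All.head facets-rest , facets-pre , AllPairs-before pre (subst (AllPairs _) Fs≡ distinct) ,
        shelling pre Fk post Fs≡ λ { refl → case-[] earlier }
        where
        case-[] : ∀ {P : List Diagram → Set} → ¬ Any P []
        case-[] ()
      from-facet : ∀ A → IsFacet D A → (y ∷ p₁ ∷ p₂ ∷ x ∷ []) ⊆≐ A → ⊥
      from-facet A facetA (y∈A ∷ p₁∈A ∷ p₂∈A ∷ x∈A ∷ []) with later-of-two Fs (complete A facetA) (complete (swap A) facetB) not-both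
        where
        facetB : IsFacet D (swap A)
        facetB = swap-facet facetA p₁∈A p₂∈A y∈A x∈A
        not-both : ∀ {z} → A ≈F z → swap A ≈F z → ⊥
        not-both (A⊆z , _) (_ , z⊆B) with ⊆≐-lookup z⊆B (⊆≐-lookup A⊆z p₁∈A)
        ... | here p₁≐q₁ = incomparable (inj₁ refl) (inj₁ refl) (inj₁ (done p₁≐q₁))
        ... | there (here p₁≐q₂) = incomparable (inj₁ refl) (inj₂ refl) (inj₁ (done p₁≐q₂))
        ... | there (there p₁∈) =
          proj₂ (∈≐-without⁻ {E = p₁} {L = A} (proj₁ (∈≐-without⁻ {E = p₂} {L = without p₁ A} p₁∈))) ≐-refl
      ... | pre , Fk , post , Fs≡ , inj₁ ((A⊆K , K⊆A) , B-earlier) =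
        let (facetK , facets-pre , distinct-pre , pure) = position pre Fk post Fs≡ B-earlier in
        not-pure-after facetK (⊆≐-lookup A⊆K p₁∈A) (⊆≐-lookup A⊆K p₂∈A) (⊆≐-lookup A⊆K y∈A) (⊆≐-lookup A⊆K x∈A)
          facets-pre distinct-pre
          (Any.map (λ (B⊆Fi , _) → ⊆≐-trans (without-mono p₂ (without-mono p₁ K⊆A)) (⊆≐-trans (without-⊆≐-swap A) B⊆Fi)) B-earlier)
          pure
      ... | pre , Fk , post , Fs≡ , inj₂ ((B⊆K , K⊆B) , A-earlier) =
        let (facetK , facets-pre , distinct-pre , pure) = position pre Fk post Fs≡ A-earlier in
        Q.not-pure-after facetK (⊆≐-lookup B⊆K (here ≐-refl)) (⊆≐-lookup B⊆K (there (here ≐-refl)))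
          (⊆≐-lookup B⊆K (∈≐-swap y∈A (outside-≉ outside-y inside-p₁) (outside-≉ outside-y inside-p₂)))
          (⊆≐-lookup B⊆K (∈≐-swap x∈A (outside-≉ outside-x inside-p₁) (outside-≉ outside-x inside-p₂)))
          facets-pre distinct-pre
          (Any.map (λ (A⊆Fi , _) → ⊆≐-trans (without-mono q₂ (without-mono q₁ K⊆B)) (⊆≐-trans (swap-without-⊆≐ A) A⊆Fi)) A-earlier)
          pure

module KohnertInterval (R C : ℕ) (D : Diagram) (bounded-D : Weights.Bounded R C D) where
  open Weights R C

  potential-step : ∀ {E F} → Reach D E → KohnertStep E F → potential F < potential E
  potential-step D→E s = StepWeight.potential-< s (reach-bounded D→E bounded-D)

  open KohnertPoset D potential potential-cong potential-step public

  -- In y the cell (p + 2 , C) of the rightmost column C can drop twice, and (p + 1 , ct) once.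
  record Configuration (y : Diagram) (p ct : ℕ) : Set where
    field
      reach-y : Reach D y
      1≤p : 1 ≤ p
      ct<C : ct < C
      top∈ : (suc (suc p) , C) ∈ y
      C-free₁ : (suc p , C) ∉ y
      C-free₀ : (p , C) ∉ y
      ct∈ : (suc p , ct) ∈ y
      ct-free₀ : (p , ct) ∉ y
      ct-rightmost : ∀ c' → (suc p , c') ∈ y → c' ≤ ct

  module ConfigurationInterval {y p ct} (K : Configuration y p ct) where
    open Configuration K

    a b c d x x' : Diagram
    a = lower (suc p) C y
    b = lower p C a
    c = lower p ct y
    d = lower (suc p) C c
    x = lower p ct b
    x' = lower p C d

    ct≢C : ct ≢ C
    ct≢C ct≡C = ℕₚ.<-irrefl ct≡C ct<C

    row≢ : ∀ {i j c₁ c₂ : ℕ} → i ≢ j → (i , c₁) ≢ (j , c₂)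
    row≢ i≢j e = i≢j (cong proj₁ e)

    Others : Diagram → Set
    Others T = ∀ j → j ≢ ct → j ≢ C → T ≐[ j ] y

    others-lower : ∀ {E r c'} → c' ≡ ct ⊎ c' ≡ C → Others E → Others (lower r c' E)
    others-lower {E} {r} {c'} c'∈ others-E j j≢ct j≢C = ≐[]-trans (lower-otherColumn r c' E c'≢j) (others-E j j≢ct j≢C)
      where
      c'≢j : c' ≢ j
      c'≢j c'≡j = Sum.[ (λ e → j≢ct (trans (sym c'≡j) e)) , (λ e → j≢C (trans (sym c'≡j) e)) ] c'∈

    others-y : Others y
    others-y _ _ _ = ≐[]-refl

    others-a : Others a
    others-a = others-lower (inj₂ refl) others-y
    others-b : Others b
    others-b = others-lower (inj₂ refl) others-a
    others-c : Others c
    others-c = others-lower (inj₁ refl) others-y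
    others-d : Others d
    others-d = others-lower (inj₂ refl) others-c
    others-x : Others x
    others-x = others-lower (inj₁ refl) others-b
    others-x' : Others x'
    others-x' = others-lower (inj₂ refl) others-d

    ≐-by-columns : ∀ {E F} → E ≐[ ct ] F → E ≐[ C ] F → Others E → Others F → E ≐ F
    ≐-by-columns {E} {F} E≐ct E≐C others-E others-F = ≐[]⇒≐ column
      where
      column : ∀ j → E ≐[ j ] F
      column j with j ≟ ct | j ≟ C
      ... | yes refl | _ = E≐ct
      ... | no _ | yes refl = E≐C
      ... | no j≢ct | no j≢C = ≐[]-trans (others-E j j≢ct j≢C) (≐[]-sym (others-F j j≢ct j≢C))

    a≐[ct]y : a ≐[ ct ] y
    a≐[ct]y = lower-otherColumn (suc p) C y (λ e → ct≢C (sym e))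
    b≐[ct]y : b ≐[ ct ] y
    b≐[ct]y = ≐[]-trans (lower-otherColumn p C a (λ e → ct≢C (sym e))) a≐[ct]y
    c≐[ct]x : c ≐[ ct ] x
    c≐[ct]x = lower-cong p ct (≐[]-sym b≐[ct]y)
    d≐[ct]x : d ≐[ ct ] x
    d≐[ct]x = ≐[]-trans (lower-otherColumn (suc p) C c (λ e → ct≢C (sym e))) c≐[ct]x
    x'≐[ct]x : x' ≐[ ct ] x
    x'≐[ct]x = ≐[]-trans (lower-otherColumn p C d (λ e → ct≢C (sym e))) d≐[ct]x

    c≐[C]y : c ≐[ C ] y
    c≐[C]y = lower-otherColumn p ct y ct≢C
    d≐[C]a : d ≐[ C ] a
    d≐[C]a = lower-cong (suc p) C c≐[C]y
    b≐[C]x : b ≐[ C ] x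
    b≐[C]x = ≐[]-sym (lower-otherColumn p ct b ct≢C)
    x'≐x : x' ≐ x
    x'≐x = ≐-by-columns x'≐[ct]x (≐[]-trans (lower-cong p C d≐[C]a) b≐[C]x) others-x' others-x

    C-free₀-a : (p , C) ∉ a
    C-free₀-a p∈a = C-free₀ (proj₁ (lower-untouched (suc p) C y (row≢ (ℕₚ.m+1+n≢n 1 ∘ sym)) (row≢ (1+n≢n ∘ sym))) p∈a)
      where open ℕₚ using (1+n≢n)

    y→a : KohnertStep y a
    y→a = lower-step top∈ (λ c' x∈ → proj₂ (bounded-y _ c' x∈)) (s≤s z≤n) C-free₁
      where bounded-y = reach-bounded reach-y bounded-D
    bounded-a : Bounded a
    bounded-a = StepWeight.bounded y→a (reach-bounded reach-y bounded-D)
    a→b : KohnertStep a b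
    a→b = lower-step (here refl) (λ c' x∈ → proj₂ (bounded-a _ c' x∈)) 1≤p C-free₀-a
    bounded-b : Bounded b
    bounded-b = StepWeight.bounded a→b bounded-a
    b→x : KohnertStep b x
    b→x = lower-step (proj₂ (b≐[ct]y (suc p)) ct∈) rightmost-b 1≤p (λ x∈ → ct-free₀ (proj₁ (b≐[ct]y p) x∈))
      where
      rightmost-b : ∀ c' → (suc p , c') ∈ b → c' ≤ ct
      rightmost-b c' x∈b with proj₁ (∈-lower p C a _) x∈b
      ... | inj₂ e = ⊥-elim (1+n≢n (cong proj₁ e)) where open ℕₚ using (1+n≢n)
      ... | inj₁ (x∈a , x≢) with proj₁ (∈-lower (suc p) C y _) x∈a
      ...   | inj₁ (x∈y , _) = ct-rightmost c' x∈y
      ...   | inj₂ e = ⊥-elim (x≢ e)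
    y→c : KohnertStep y c
    y→c = lower-step ct∈ ct-rightmost 1≤p ct-free₀
    bounded-c : Bounded c
    bounded-c = StepWeight.bounded y→c (reach-bounded reach-y bounded-D)
    c→d : KohnertStep c d
    c→d = lower-step (proj₂ (c≐[C]y _) top∈) (λ c' x∈ → proj₂ (bounded-c _ c' x∈)) (s≤s z≤n) (λ x∈ → C-free₁ (proj₁ (c≐[C]y _) x∈))
    bounded-d : Bounded d
    bounded-d = StepWeight.bounded c→d bounded-c
    d→x' : KohnertStep d x'
    d→x' = lower-step (here refl) (λ c' x∈ → proj₂ (bounded-d _ c' x∈)) 1≤p (λ x∈ → C-free₀-a (proj₁ (d≐[C]a p) x∈))

    bounded-y : Bounded y
    bounded-y = reach-bounded reach-y bounded-D

    ct-weight-x : weight ct x + 1 ≡ weight ct y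
    ct-weight-x = trans (cong (_+ 1) (sym (weight-cong c≐[ct]x))) (lower-weight ct∈ ct-rightmost 1≤p ct-free₀ bounded-y)

    C-weight-a : weight C a + 1 ≡ weight C y
    C-weight-a = lower-weight top∈ (λ c' x∈ → proj₂ (bounded-y _ c' x∈)) (s≤s z≤n) C-free₁ bounded-y

    C-weight-b : weight C b + 1 ≡ weight C a
    C-weight-b = lower-weight (here refl) (λ c' x∈ → proj₂ (bounded-a _ c' x∈)) 1≤p C-free₀-a bounded-a

    C-weight-x : weight C x + 1 ≡ weight C a
    C-weight-x = trans (cong (_+ 1) (sym (weight-cong b≐[C]x))) C-weight-b

    +1≡⇒< : ∀ {m n} → m + 1 ≡ n → m < n
    +1≡⇒< {m} refl = ℕₚ.m<m+n m (s≤s z≤n)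

    -- The two unit drops must take (p + 2 , C) to row p + 1 and then on to row p, as rows p and p + 1 of column C are empty in y.
    C-middle : ∀ {z} → UnitDrop C y z → UnitDrop C z x → z ≐[ C ] a
    C-middle {z} first second i = to , from
      where
      module U₁ = UnitDrop first
      module U₂ = UnitDrop second
      row₁≡ : U₁.row ≡ suc (suc p)
      row₁≡ with proj₁ (U₂.∈-column p) (proj₁ (b≐[C]x p) (here refl))
      ... | inj₁ (p∈z , _) with proj₁ (U₁.∈-column p) p∈z
      ...   | inj₁ (p∈y , _) = ⊥-elim (C-free₀ p∈y)
      ...   | inj₂ p≡t₁ = ⊥-elim (C-free₁ (subst (λ k → (k , C) ∈ y) (trans (sym U₁.adjacent) (cong suc (sym p≡t₁))) U₁.row∈))
      row₁≡ | inj₂ p≡t₂ with proj₁ (U₁.∈-column (suc p)) (subst (λ k → (k , C) ∈ z) (trans (sym U₂.adjacent) (cong suc (sym p≡t₂))) U₂.row∈)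
      ... | inj₁ (p+1∈y , _) = ⊥-elim (C-free₁ p+1∈y)
      ... | inj₂ p+1≡t₁ = trans (sym U₁.adjacent) (cong suc (sym p+1≡t₁))
      target₁≡ : U₁.target ≡ suc p
      target₁≡ = ℕₚ.suc-injective (trans U₁.adjacent row₁≡)
      to : (i , C) ∈ z → (i , C) ∈ a
      to i∈z with proj₁ (U₁.∈-column i) i∈z
      ... | inj₁ (i∈y , i≢) = proj₂ (∈-lower (suc p) C y _) (inj₁ (i∈y , λ e → i≢ (trans (cong proj₁ e) (sym row₁≡))))
      ... | inj₂ i≡ = proj₂ (∈-lower (suc p) C y _) (inj₂ (cong (_, C) (trans i≡ target₁≡)))
      from : (i , C) ∈ a → (i , C) ∈ z
      from i∈a with proj₁ (∈-lower (suc p) C y _) i∈a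
      ... | inj₁ (i∈y , i≢) = proj₂ (U₁.∈-column i) (inj₁ (i∈y , λ e → i≢ (cong (_, C) (trans e row₁≡))))
      ... | inj₂ i≡ = proj₂ (U₁.∈-column i) (inj₂ (trans (cong proj₁ i≡) (sym target₁≡)))

    module Between {z} (y→z : Reach y z) (z→x : Reach z x) where
      bounded-z : Bounded z
      bounded-z = reach-bounded y→z bounded-y

      others-z : Others z
      others-z j j≢ct j≢C = ≐[]-sym (weight-reach-sandwich j y→z z→x bounded-y (weight-cong (others-x j j≢ct j≢C)))

      ct-column : z ≐[ ct ] y ⊎ z ≐[ ct ] x
      ct-column with weight-reach-trichotomy ct y→z z→x bounded-y
      ... | inj₁ y≐z = inj₁ (≐[]-sym y≐z)
      ... | inj₂ (inj₁ z≐x) = inj₂ z≐x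
      ... | inj₂ (inj₂ (x<z , z<y)) =
        ⊥-elim (ℕₚ.<-irrefl refl (ℕₚ.<-≤-trans z<y (subst (_≤ weight ct z) (trans (ℕₚ.+-comm 1 _) ct-weight-x) x<z)))

      C-column : z ≐[ C ] y ⊎ z ≐[ C ] a ⊎ z ≐[ C ] x
      C-column with weight-reach-trichotomy C y→z z→x bounded-y
      ... | inj₁ y≐z = inj₁ (≐[]-sym y≐z)
      ... | inj₂ (inj₁ z≐x) = inj₂ (inj₂ z≐x)
      ... | inj₂ (inj₂ (x<z , z<y)) = inj₂ (inj₁ (C-middle (unitDrop C y→z bounded-y (trans (cong (_+ 1) z≡a) C-weight-a))
                                                          (unitDrop C z→x bounded-z (trans C-weight-x (sym z≡a)))))
        where
        z≡a : weight C z ≡ weight C a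
        z≡a = ℕₚ.≤-antisym (ℕₚ.≤-pred (subst (weight C z <_) (trans (sym C-weight-a) (ℕₚ.+-comm _ 1)) z<y))
                           (subst (_≤ weight C z) (trans (ℕₚ.+-comm 1 _) C-weight-x) x<z)

      classification : (z ≐ y) ⊎ (z ≐ x) ⊎ (z ≐ a) ⊎ (z ≐ b) ⊎ (z ≐ c) ⊎ (z ≐ d)
      classification with ct-column | C-column
      ... | inj₁ z≐y | inj₁ z≐[C]y = inj₁ (≐-by-columns z≐y z≐[C]y others-z others-y)
      ... | inj₁ z≐y | inj₂ (inj₁ z≐a) = inj₂ (inj₂ (inj₁ (≐-by-columns (≐[]-trans z≐y (≐[]-sym a≐[ct]y)) z≐a others-z others-a)))
      ... | inj₁ z≐y | inj₂ (inj₂ z≐x) = inj₂ (inj₂ (inj₂ (inj₁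
              (≐-by-columns (≐[]-trans z≐y (≐[]-sym b≐[ct]y)) (≐[]-trans z≐x (≐[]-sym b≐[C]x)) others-z others-b))))
      ... | inj₂ z≐x | inj₁ z≐[C]y = inj₂ (inj₂ (inj₂ (inj₂ (inj₁
              (≐-by-columns (≐[]-trans z≐x (≐[]-sym c≐[ct]x)) (≐[]-trans z≐[C]y (≐[]-sym c≐[C]y)) others-z others-c)))))
      ... | inj₂ z≐x | inj₂ (inj₁ z≐a) = inj₂ (inj₂ (inj₂ (inj₂ (inj₂
              (≐-by-columns (≐[]-trans z≐x (≐[]-sym d≐[ct]x)) (≐[]-trans z≐a (≐[]-sym d≐[C]a)) others-z others-d)))))
      ... | inj₂ z≐x | inj₂ (inj₂ z≐[C]x) = inj₂ (inj₁ (≐-by-columns z≐x z≐[C]x others-z others-x))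

    ct-lower : ∀ {u v} → u ≐[ ct ] y → v ≐[ ct ] x → weight ct v < weight ct u
    ct-lower u≐y v≐x = subst₂ _<_ (sym (weight-cong v≐x)) (sym (weight-cong u≐y)) (+1≡⇒< ct-weight-x)
  
    C-a<c : weight C a < weight C c
    C-a<c = subst (weight C a <_) (sym (weight-cong c≐[C]y)) (+1≡⇒< C-weight-a)

    C-b<d : weight C b < weight C d
    C-b<d = subst (weight C b <_) (sym (weight-cong d≐[C]a)) (+1≡⇒< C-weight-b)

    -- From a to d the cell (p + 1 , ct) has to drop while (p + 1 , C) is still in its row.
    ¬a→d : ¬ Reach a d
    ¬a→d a→d = ℕₚ.<-irrefl refl (ℕₚ.<-≤-trans ct<C (U.rightmost C (subst (λ k → (k , C) ∈ U.middle) row≡ p+1∈middle)))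
      where
      U : UnitDrop ct a d
      U = unitDrop ct a→d bounded-a
            (trans (cong (_+ 1) (weight-cong d≐[ct]x)) (trans ct-weight-x (sym (weight-cong a≐[ct]y))))
      module U = UnitDrop U
      p+1∈middle : (suc p , C) ∈ U.middle
      p+1∈middle = proj₁ (weight-reach-sandwich C U.reach-middle U.middle-reach bounded-a (weight-cong d≐[C]a) (suc p)) (here refl)
      ct∉d : (suc p , ct) ∉ d
      ct∉d x∈d with proj₁ (∈-lower p ct b _) (proj₁ (d≐[ct]x (suc p)) x∈d)
      ... | inj₁ (_ , x≢) = x≢ refl
      ... | inj₂ e = 1+n≢n (cong proj₁ e) where open ℕₚ using (1+n≢n)
      row≡ : suc p ≡ U.row
      row≡ with suc p ≟ U.row
      ... | yes p+1≡ = p+1≡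
      ... | no p+1≢ = ⊥-elim (ct∉d (proj₂ (U.∈-column (suc p)) (inj₁ (proj₂ (a≐[ct]y (suc p)) ct∈ , p+1≢))))

    incomparable : ∀ {u v} → (u ≡ a ⊎ u ≡ b) → (v ≡ c ⊎ v ≡ d) → ¬ Comparable u v
    incomparable (inj₁ refl) (inj₁ refl) (inj₁ a→c) = weight-<⇒¬reach C C-a<c bounded-a a→c
    incomparable (inj₁ refl) (inj₂ refl) (inj₁ a→d) = ¬a→d a→d
    incomparable (inj₂ refl) (inj₁ refl) (inj₁ b→c) = weight-<⇒¬reach C (ℕₚ.<-trans (+1≡⇒< C-weight-b) C-a<c) bounded-b b→c
    incomparable (inj₂ refl) (inj₂ refl) (inj₁ b→d) = weight-<⇒¬reach C C-b<d bounded-b b→d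
    incomparable (inj₁ refl) (inj₁ refl) (inj₂ c→a) = weight-<⇒¬reach ct (ct-lower a≐[ct]y c≐[ct]x) bounded-c c→a
    incomparable (inj₁ refl) (inj₂ refl) (inj₂ d→a) = weight-<⇒¬reach ct (ct-lower a≐[ct]y d≐[ct]x) bounded-d d→a
    incomparable (inj₂ refl) (inj₁ refl) (inj₂ c→b) = weight-<⇒¬reach ct (ct-lower b≐[ct]y c≐[ct]x) bounded-c c→b
    incomparable (inj₂ refl) (inj₂ refl) (inj₂ d→b) = weight-<⇒¬reach ct (ct-lower b≐[ct]y d≐[ct]x) bounded-d d→b

    split : SplitInterval y x a b c d
    split = record
      { reach-top = reach-y
      ; y→p₁ = reach-step y→a ; p₁→p₂ = reach-step a→b ; p₂→x = reach-step b→x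
      ; y→q₁ = reach-step y→c ; q₁→q₂ = reach-step c→d ; q₂→x = step d→x' (done x'≐x)
      ; p₁<y = potential-step reach-y y→a
      ; p₂<p₁ = potential-step D→a a→b
      ; x<p₂ = potential-step (reach-trans D→a (reach-step a→b)) b→x
      ; q₁<y = potential-step reach-y y→c
      ; q₂<q₁ = potential-step D→c c→d
      ; x<q₂ = subst (_< potential d) (potential-cong x'≐x) (potential-step (reach-trans D→c (reach-step c→d)) d→x')
      ; incomparable = incomparable
      ; interval = λ z y→z z→x → Between.classification y→z z→x }
      where
      D→a : Reach D a
      D→a = reach-trans reach-y (reach-step y→a)
      D→c : Reach D c
      D→c = reach-trans reach-y (reach-step y→c)

module LastColumnMoves (R C : ℕ) where
  open Weights R C

  lower-lastColumn : ∀ {E r} → Bounded E → (suc r , C) ∈ E → 1 ≤ r → (r , C) ∉ E → KohnertStep E (lower r C E)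
  lower-lastColumn bE src∈ 1≤r tgt∉ = lower-step src∈ (λ c' x∈ → proj₂ (bE _ c' x∈)) 1≤r tgt∉

  record Rearrangement (E : Diagram) (Fixed : ℕ → Set) (Goal : Diagram → Set) : Set where
    field
      result : Diagram
      reach : Reach E result
      goal : Goal result
      otherColumns : ∀ {j} → j ≢ C → E ≐[ j ] result
      fixedRows : ∀ {i} → Fixed i → ((i , C) ∈ E) ⇔ ((i , C) ∈ result)

  unchanged : ∀ {E Fixed} {Goal : Diagram → Set} → Goal E → Rearrangement E Fixed Goal
  unchanged goal = record { result = _ ; reach = reach-refl ; goal = goal ; otherColumns = λ _ → ≐[]-refl ; fixedRows = λ _ → ⇔-refl }

  weaken : ∀ {E Fixed Fixed'} {Goal Goal' : Diagram → Set} → (∀ {i} → Fixed' i → Fixed i) → (∀ {F} → Goal F → Goal' F) →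
           Rearrangement E Fixed Goal → Rearrangement E Fixed' Goal'
  weaken fixed⇒ goal⇒ Z = record
    { result = Z.result ; reach = Z.reach ; goal = goal⇒ Z.goal ; otherColumns = Z.otherColumns ; fixedRows = λ i → Z.fixedRows (fixed⇒ i) }
    where module Z = Rearrangement Z

  lower-then : ∀ {E r Fixed Goal} → Bounded E → (suc r , C) ∈ E → 1 ≤ r → (r , C) ∉ E →
               (∀ {i} → Fixed i → i ≢ suc r × i ≢ r) → Rearrangement (lower r C E) Fixed Goal → Rearrangement E Fixed Goal
  lower-then {E} {r} bE src∈ 1≤r tgt∉ untouched Z = record
    { result = result ; reach = step (lower-lastColumn bE src∈ 1≤r tgt∉) reach ; goal = goal
    ; otherColumns = λ j≢C → ≐[]-trans (≐[]-sym (lower-otherColumn r C E (λ e → j≢C (sym e)))) (otherColumns j≢C)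
    ; fixedRows = λ i → ⇔-trans (⇔-sym (lower-untouched r C E (row≢ (proj₁ (untouched i))) (row≢ (proj₂ (untouched i))))) (fixedRows i) }
    where
    open Rearrangement Z
    row≢ : ∀ {i j : ℕ} → i ≢ j → (i , C) ≢ (j , C)
    row≢ i≢j e = i≢j (cong proj₁ e)

  bring-down : ∀ k {m E} → 1 ≤ m → Bounded E → (k + m , C) ∈ E → Rearrangement E (_< m) (λ F → (m , C) ∈ F)
  bring-down zero _ _ m∈ = unchanged m∈
  bring-down (suc k) {m} {E} 1≤m bE src∈ with (k + m , C) ∈? E
  ... | yes below∈ = bring-down k 1≤m bE below∈
  ... | no below∉ = lower-then bE src∈ 1≤k+m below∉ untouched
                      (bring-down k 1≤m (StepWeight.bounded (lower-lastColumn bE src∈ 1≤k+m below∉) bE) (here refl))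
    where
    m≤k+m : m ≤ k + m
    m≤k+m = ℕₚ.m≤n+m m k
    1≤k+m : 1 ≤ k + m
    1≤k+m = ℕₚ.≤-trans 1≤m m≤k+m
    untouched : ∀ {i} → i < m → i ≢ suc (k + m) × i ≢ k + m
    untouched i<m = (λ e → ℕₚ.<-irrefl e (ℕₚ.<-≤-trans i<m (ℕₚ.m≤n⇒m≤1+n m≤k+m)))
                  , (λ e → ℕₚ.<-irrefl e (ℕₚ.<-≤-trans i<m m≤k+m))

  two-free-≡ : ∀ {v w F} → v ≡ w → ((v , C) ∉ F) × ((suc v , C) ∉ F) → ((w , C) ∉ F) × ((suc w , C) ∉ F)
  two-free-≡ refl free = free

  -- Empty rows u and u + 1 of column C are pushed up to rows u + n and u + n + 1 by moving cells down two rows.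
  clear-two : ∀ n {u E} → 1 ≤ u → Bounded E → (u , C) ∉ E → (suc u , C) ∉ E →
              Rearrangement E (λ i → suc (u + n) < i) (λ F → ((u + n , C) ∉ F) × ((suc (u + n) , C) ∉ F))
  clear-two zero {u} 1≤u bE u∉ u+1∉ = weaken (λ i → i) (two-free-≡ (sym (ℕₚ.+-identityʳ u))) (unchanged (u∉ , u+1∉))
  clear-two (suc n) {u} {E} 1≤u bE u∉ u+1∉ with (suc (suc u) , C) ∈? E
  ... | no u+2∉ = weaken (λ {i} → subst (_< i) (cong suc (ℕₚ.+-suc u n))) (two-free-≡ (sym (ℕₚ.+-suc u n)))
                    (clear-two n (ℕₚ.m≤n⇒m≤1+n 1≤u) bE u+1∉ u+2∉)
  ... | yes u+2∈ = weaken (λ {i} → subst (_< i) (cong suc (ℕₚ.+-suc u n))) (two-free-≡ (sym (ℕₚ.+-suc u n)))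
                     (lower-then bE u+2∈ (s≤s z≤n) u+1∉ (λ i → rows≢ (above i) , rows≢ (ℕₚ.<⇒≤ (above i)))
                     (lower-then bE₁ (here refl) 1≤u u∉E₁ (λ i → rows≢ (ℕₚ.<⇒≤ (above i)) , rows≢ (ℕₚ.<⇒≤ (ℕₚ.<⇒≤ (above i))))
                     (clear-two n (ℕₚ.m≤n⇒m≤1+n 1≤u) bE₂ u+1∉E₂ u+2∉E₂)))
    where
    rows≢ : ∀ {i v} → suc v ≤ i → i ≢ v
    rows≢ v<i i≡v = ℕₚ.<-irrefl (sym i≡v) v<i
    above : ∀ {i} → suc (suc (u + n)) < i → suc (suc u) < i
    above = ℕₚ.≤-trans (s≤s (s≤s (s≤s (ℕₚ.m≤m+n u n))))
    E₁ : Diagram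
    E₁ = lower (suc u) C E
    bE₁ : Bounded E₁
    bE₁ = StepWeight.bounded (lower-lastColumn bE u+2∈ (s≤s z≤n) u+1∉) bE
    u∉E₁ : (u , C) ∉ E₁
    u∉E₁ u∈ = u∉ (proj₁ (lower-untouched (suc u) C E (λ e → ℕₚ.m+1+n≢n 1 (sym (cong proj₁ e))) (λ e → ℕₚ.1+n≢n (sym (cong proj₁ e)))) u∈)
    bE₂ : Bounded (lower u C E₁)
    bE₂ = StepWeight.bounded (lower-lastColumn bE₁ (here refl) 1≤u u∉E₁) bE₁
    u+1∉E₂ : (suc u , C) ∉ lower u C E₁
    u+1∉E₂ u+1∈ with proj₁ (∈-lower u C E₁ _) u+1∈
    ... | inj₁ (_ , ≢u+1) = ≢u+1 refl
    ... | inj₂ e = ℕₚ.1+n≢n (cong proj₁ e)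
    u+2∉E₂ : (suc (suc u) , C) ∉ lower u C E₁
    u+2∉E₂ u+2∈ with proj₁ (∈-lower u C E₁ _) u+2∈
    ... | inj₂ e = ℕₚ.m+1+n≢n 1 (cong proj₁ e)
    ... | inj₁ (u+2∈E₁ , _) with proj₁ (∈-lower (suc u) C E _) u+2∈E₁
    ...   | inj₁ (_ , ≢u+2) = ≢u+2 refl
    ...   | inj₂ e = ℕₚ.1+n≢n (cong proj₁ e)

rightmost-below : ∀ C q {c₀} E → (q , c₀) ∈ E → c₀ < C →
                  ∃[ ct ] ((q , ct) ∈ E) × (ct < C) × (∀ c' → (q , c') ∈ E → c' < C → c' ≤ ct)
rightmost-below C q {c₀} E c₀∈ c₀<C = proj₂ best , best∈ , proj₂ (proj₂ best-candidate) , maximal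
  where
  Candidate : Cell → Set
  Candidate (r , c) = r ≡ q × c < C
  candidate? : ∀ x → Dec (Candidate x)
  candidate? (r , c) = (r ≟ q) ×-dec (c <? C)
  candidates : List Cell
  candidates = filter candidate? E
  best : Cell
  best = argmax proj₂ (q , c₀) candidates
  best-candidate : (best ∈ E) × Candidate best
  best-candidate = argmax-all proj₂ {P = λ z → (z ∈ E) × Candidate z} (c₀∈ , refl , c₀<C)
                     (All.tabulate (∈-filter⁻ candidate?))
  best∈ : (q , proj₂ best) ∈ E
  best∈ = subst (λ r → (r , proj₂ best) ∈ E) (proj₁ (proj₂ best-candidate)) (proj₁ best-candidate)
  maximal : ∀ c' → (q , c') ∈ E → c' < C → c' ≤ proj₂ best
  maximal c' x∈ c'<C = All.lookup (f[xs]≤f[argmax] (q , c₀) candidates) (∈-filter⁺ candidate? x∈ (refl , c'<C))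

module DiagramAboveRowTwo (D : Diagram) (rows>2 : ∀ r c → (r , c) ∈ D → (2 < r) × (1 ≤ c))
                (C : ℕ) (columns≤C : ∀ r c → (r , c) ∈ D → c ≤ C) where

  R : ℕ
  R = max 0 (map proj₁ D)

  bounded-D : Weights.Bounded R C D
  bounded-D r c x∈ = All.lookup (xs≤max 0 (map proj₁ D)) (∈-map⁺ proj₁ x∈) , columns≤C r c x∈

  open Weights R C
  open KohnertInterval R C D bounded-D
  open LastColumnMoves R C

  record Descent (rs : ℕ) : Set where
    field
      p ct : ℕ
      ct∈ : (suc p , ct) ∈ D
      ct<C : ct < C
      ct-rightmost : ∀ c' → (suc p , c') ∈ D → c' < C → c' ≤ ct
      ct-free₀ : (p , ct) ∉ D
      p+1<rs : suc p < rs
      2≤p : 2 ≤ p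

  descend : ∀ {rs} q {c₀} → (q , c₀) ∈ D → c₀ < C → q < rs → Descent rs
  descend zero x∈ _ _ = ⊥-elim (ℕₚ.<-irrefl refl (ℕₚ.<-trans (proj₁ (rows>2 _ _ x∈)) (s≤s z≤n)))
  descend (suc p) x∈ c₀<C q<rs with rightmost-below C (suc p) D x∈ c₀<C
  ... | ct , ct∈ , ct<C , ct-rightmost with (p , ct) ∈? D
  ...   | yes below∈ = descend p below∈ ct<C (ℕₚ.<-trans (ℕₚ.n<1+n p) q<rs)
  ...   | no below∉ = record { p = p ; ct = ct ; ct∈ = ct∈ ; ct<C = ct<C ; ct-rightmost = ct-rightmost
                             ; ct-free₀ = below∉ ; p+1<rs = q<rs ; 2≤p = ℕₚ.≤-pred (proj₁ (rows>2 _ _ ct∈)) }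

  configuration : ∀ {rs rt ct₀} → (rs , C) ∈ D → (rt , ct₀) ∈ D → ct₀ < C → rt < rs → ∃[ y ] ∃[ p ] ∃[ ct ] Configuration y p ct
  configuration {rs} {rt} top∈ cell∈ ct₀<C rt<rs = _ , p , ct , record
    { reach-y = reach-trans Lift.reach Clear.reach
    ; 1≤p = 1≤p
    ; ct<C = ct<C
    ; top∈ = proj₁ (Clear.fixedRows (subst (λ v → suc v < suc (suc p)) (sym 1+[p-1]≡p) ℕₚ.≤-refl)) Lift.goal
    ; C-free₁ = proj₂ Clear-goal
    ; C-free₀ = proj₁ Clear-goal
    ; ct∈ = proj₁ (ct-column (suc p)) ct∈
    ; ct-free₀ = λ x∈ → ct-free₀ (proj₂ (ct-column p) x∈)
    ; ct-rightmost = rightmost }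
    where
    open Descent (descend rt cell∈ ct₀<C rt<rs)
    1≤p : 1 ≤ p
    1≤p = ℕₚ.≤-trans (s≤s z≤n) 2≤p
    module Lift = Rearrangement (bring-down (rs ∸ suc (suc p)) (s≤s z≤n) bounded-D
                    (subst (λ v → (v , C) ∈ D) (sym (ℕₚ.m∸n+n≡m p+1<rs)) top∈))
    low-free : ∀ i → i ≤ 2 → (i , C) ∉ Lift.result
    low-free i i≤2 x∈ = ℕₚ.<-irrefl refl (ℕₚ.≤-trans (proj₁ (rows>2 _ _ x∈D)) i≤2)
      where
      x∈D : (i , C) ∈ D
      x∈D = proj₂ (Lift.fixedRows (s≤s (ℕₚ.≤-trans i≤2 (ℕₚ.m≤n⇒m≤1+n 2≤p)))) x∈
    module Clear = Rearrangement (clear-two (p ∸ 1) {1} ℕₚ.≤-refl (reach-bounded Lift.reach bounded-D)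
                                    (low-free 1 (s≤s z≤n)) (low-free 2 ℕₚ.≤-refl))
    1+[p-1]≡p : 1 + (p ∸ 1) ≡ p
    1+[p-1]≡p = ℕₚ.m+[n∸m]≡n 1≤p
    Clear-goal : ((p , C) ∉ Clear.result) × ((suc p , C) ∉ Clear.result)
    Clear-goal = two-free-≡ 1+[p-1]≡p Clear.goal
    ct≢C : ct ≢ C
    ct≢C ct≡C = ℕₚ.<-irrefl ct≡C ct<C
    ct-column : D ≐[ ct ] Clear.result
    ct-column = ≐[]-trans (Lift.otherColumns ct≢C) (Clear.otherColumns ct≢C)
    rightmost : ∀ c' → (suc p , c') ∈ Clear.result → c' ≤ ct
    rightmost c' x∈ with c' ≟ C
    ... | yes refl = ⊥-elim (proj₂ Clear-goal x∈)
    ... | no c'≢C = ct-rightmost c' x∈D (ℕₚ.≤∧≢⇒< (columns≤C _ _ x∈D) c'≢C)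
      where
      x∈D : (suc p , c') ∈ D
      x∈D = proj₂ (≐[]-trans (Lift.otherColumns c'≢C) (Clear.otherColumns c'≢C) (suc p)) x∈

  cell-below⇒¬shellable : ∀ {rs rt ct₀} → (rs , C) ∈ D → (rt , ct₀) ∈ D → ct₀ < C → rt < rs → ¬ KohnertShellable D
  cell-below⇒¬shellable top∈ cell∈ ct₀<C rt<rs with configuration top∈ cell∈ ct₀<C rt<rs
  ... | _ , _ , _ , K = SplitFacets.split⇒¬shellable (ConfigurationInterval.split K)

lemma4p12 : (D : Diagram)
    → (∀ r c → (r , c) ∈ D → (2 < r) × (1 ≤ c))
    → KohnertShellable D
    → (cs : ℕ) → (∀ r c → (r , c) ∈ D → c ≤ cs)
    → (rs : ℕ) → (rs , cs) ∈ D → (∀ r → (r , cs) ∈ D → r ≤ rs)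
    → ∀ rt ct → (rt , ct) ∈ D → ct < cs → rs ≤ rt
lemma4p12 D rows>2 shellable cs columns≤cs rs top∈ _ rt ct cell∈ ct<cs with rs ≤? rt
... | yes rs≤rt = rs≤rt
... | no rs≰rt = ⊥-elim (DiagramAboveRowTwo.cell-below⇒¬shellable D rows>2 cs columns≤cs top∈ cell∈ ct<cs (ℕₚ.≰⇒> rs≰rt) shellable)
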